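{- Let $w$ be an irreducible packed word, let $w=x\triangleleft_R(y\triangleleft_B z)$ be its red-blue-factorization and $w=y'\triangleleft_B(x'\triangleleft_R z')$ its blue-red-factorization. Then $z=z'$, and this word is both red-irreducible and blue-irreducible. Moreover, either $z=z'=1$, $y=x'=\varepsilon$ and $x=y'$, or $x=x'$ and $y=y'$.
   Context: Words over positive integers; $|w|$ length, $\max(w)$ largest letter ($\max(\varepsilon)=0$), $w^{[k]}$ adds $k$ to every letter; $1$ denotes the packed word of length one. Packed: every integer $1..\max(w)$ occurs. $u\odot v=u^{[\max(v)]}\cdot v$. Global descent of $w$ of length $n$: $1\le c\le n-1$ with every letter of $w_1..w_c$ strictly greater than every letter of $w_{c+1}..w_n$; irreducible = nonempty without global descent. Red: for packed $w$ of length $n$, $p\ge1$, $I=\{i_1<\dots<i_p\}\subseteq\{1..n+p\}$, $\phi_I(w)$ has letter $\max(w)+1$ at positions of $I$ and letters of $w$ in order elsewhere; nonempty packed $v$ is uniquely $\phi_I(v')$, and $u\triangleleft_R v=\phi_{I+|u|}(u\odot v')$. Blue: $\psi_{i^\circ}(w)$ ($1\le i\le\max(w)+1$) adds $1$ to letters $\ge i$ and appends $i$; $\psi_{i^\bullet}(w)=w\cdot i$ ($1\le i\le\max(w)$); nonempty packed $v$ is uniquely $\psi_{i^\alpha}(v')$, and $u\triangleleft_B v=\psi_{(i+\max(u))^\alpha}(v'\odot u)$. For irreducible $w$, its red- (resp. blue-) factorization is the unique pair $(u,v)$ of packed words with $v\ne\varepsilon$, $w=u\triangleleft_R v$ (resp.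 $u\triangleleft_B v$), $|u|$ maximal. Red-blue-factorization of irreducible $w$: $w=x\triangleleft_R(y\triangleleft_B z)$ where $(x,u)$ is the red-factorization of $w$ and $(y,z)$ the blue-factorization of $u$. Blue-red-factorization: $w=y'\triangleleft_B(x'\triangleleft_R z')$ where $(y',u')$ is the blue-factorization of $w$ and $(x',z')$ the red-factorization of $u'$. A packed word is red- (resp. blue-) irreducible if it is irreducible and $w=u\triangleleft_R v$ (resp. $u\triangleleft_B v$) with $v\ne\varepsilon$ forces $u=\varepsilon$. -}

module Defs where

open import Data.Nat using (ℕ; zero; suc; _+_; _≤_; _<_; _⊔_; _≡ᵇ_; _<ᵇ_; _≤ᵇ_)
open import Data.Bool using (Bool; true; false; if_then_else_)
open import Data.List using (List; []; _∷_; _++_; map; length; take; drop; reverse; replicate; foldr; [_])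
open import Data.Bool.ListAction using (any)
open import Data.List.Membership.Propositional using (_∈_)
open import Data.Product using (_×_; _,_; ∃-syntax)
open import Relation.Binary.PropositionalEquality using (_≡_; _≢_)
open import Relation.Nullary using (¬_)

-- Words over positive integers are lists of naturals; positivity is part of Packed.
Word : Set
Word = List ℕ

maxW : Word → ℕ
maxW = foldr _⊔_ 0

shiftW : ℕ → Word → Word
shiftW k = map (k +_)

_⊙_ : Word → Word → Word
u ⊙ v = shiftW (maxW v) u ++ v

Packed : Word → Set
Packed w = (∀ a → a ∈ w → 1 ≤ a) × (∀ k → 1 ≤ k → k ≤ maxW w → k ∈ w)

GlobalDescent : Word → ℕ → Set
GlobalDescent w c = 1 ≤ c × c < length w ×
  (∀ a b → a ∈ take c w → b ∈ drop c w → b < a)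

Irreducible : Word → Set
Irreducible w = w ≢ [] × ¬ (∃[ c ] GlobalDescent w c)

fill : ℕ → List Bool → Word → Word
fill c [] w = []
fill c (true ∷ I) w = c ∷ fill c I w
fill c (false ∷ I) [] = []
fill c (false ∷ I) (a ∷ w) = a ∷ fill c I w

-- φ_I(w), the set I ⊆ {1..n+p} given as its indicator list of length n+p
φ : List Bool → Word → Word
φ I w = fill (suc (maxW w)) I w

-- decomposition v = φ_I(v') of a nonempty packed v:
-- I = positions of max(v), v' = v with the letters max(v) removed
redMask : Word → List Bool
redMask v = map (λ a → a ≡ᵇ maxW v) v

removeBelow : ℕ → Word → Word
removeBelow m [] = []
removeBelow m (a ∷ w) = if a <ᵇ m then a ∷ removeBelow m w else removeBelow m w

redRest : Word → Word
redRest v = removeBelow (maxW v) v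

-- u ◁R v = φ_{I+|u|}(u ⊙ v')
_◁R_ : Word → Word → Word
u ◁R v = φ (replicate (length u) false ++ redMask v) (u ⊙ redRest v)

-- ψ_{i^∘} (flag true) and ψ_{i^•} (flag false)
ψ : Bool → ℕ → Word → Word
ψ true i w = map (λ a → if i ≤ᵇ a then suc a else a) w ++ [ i ]
ψ false i w = w ++ [ i ]

-- decomposition v = ψ_{i^α}(v') of a nonempty packed v = v''·i :
-- α = • if i occurs in v'' (then v' = v''), α = ∘ otherwise (then v' = v'' with letters > i decreased by 1)
record BlueDec : Set where
  constructor bdec
  field
    circ : Bool
    letter : ℕ
    rest : Word

decLetter : ℕ → ℕ → ℕ
decLetter i zero = zero
decLetter i (suc a) = if i <ᵇ suc a then a else suc a

blueDecomp : Word → BlueDec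
blueDecomp v with reverse v
... | [] = bdec false 0 []
... | i ∷ r with any (λ a → a ≡ᵇ i) (reverse r)
...   | true = bdec false i (reverse r)
...   | false = bdec true i (map (decLetter i) (reverse r))

_◁B_ : Word → Word → Word
u ◁B v with blueDecomp v
... | bdec α i v' = ψ α (i + maxW u) (v' ⊙ u)

IsRedFact : Word → Word → Word → Set
IsRedFact w u v = Packed u × Packed v × v ≢ [] × w ≡ u ◁R v ×
  (∀ u₂ v₂ → Packed u₂ → Packed v₂ → v₂ ≢ [] → w ≡ u₂ ◁R v₂ → length u₂ ≤ length u)

IsBlueFact : Word → Word → Word → Set
IsBlueFact w u v = Packed u × Packed v × v ≢ [] × w ≡ u ◁B v ×
  (∀ u₂ v₂ → Packed u₂ → Packed v₂ → v₂ ≢ [] → w ≡ u₂ ◁B v₂ → length u₂ ≤ length u)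

RedIrreducible : Word → Set
RedIrreducible w = Packed w × Irreducible w ×
  (∀ u v → Packed u → Packed v → v ≢ [] → w ≡ u ◁R v → u ≡ [])

BlueIrreducible : Word → Set
BlueIrreducible w = Packed w × Irreducible w ×
  (∀ u v → Packed u → Packed v → v ≢ [] → w ≡ u ◁B v → u ≡ [])

{-# OPTIONS --safe #-}

-- Both products have explicit forms: x ◁R u is x shifted by max u − 1 followed by u with
-- its largest letter renamed to max x + max u, and y ◁B (p·i) is p shifted by max y, then y,
-- then i + max y. From these, ◁R and ◁B cancel once the length of the left factor is fixed,
-- associate with ⊙, and commute: y ◁B (x ◁R z) = x ◁R (y ◁B z). Hence w = y ◁B (x ◁R z)
-- = x′ ◁R (y′ ◁B z′), so maximality gives |y| ≤ |y′| and |x′| ≤ |x|; maximality also leaves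
-- no nontrivial red or blue left factor in z, and a global descent of z would lift to w. If |w| ≤ |x| + |y′|, the shifted copy of x meets
-- y′, which forces the last letter of w to be a new maximum: w = W·(max W + 1), and both
-- factorizations are the trivial ones, with z = z′ = 1. Otherwise y′ and the last letter lie
-- in the renamed copy of u, so u = y′ ◁B Z and u′ = x ◁R Z; this gives the reverse
-- inequalities, and cancellation yields x = x′, y = y′, z = z′.

module Submission where

open import Defs
open import Data.Bool using (true; false; if_then_else_; T)
open import Data.Bool.ListAction using (any)
open import Data.Empty using (⊥-elim)
open import Data.List using (List; []; _∷_; _++_; _∷ʳ_; [_]; map; length; replicate; reverse; take; drop; initLast; _∷ʳ′_)
open import Data.List.Membership.Propositional using (_∈_)
open import Data.List.Membership.Propositional.Properties using (∈-map⁺; ∈-map⁻; ∈-++⁺ˡ; ∈-++⁺ʳ; ∈-++⁻)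
open import Data.List.Properties
  using (∷-injective; ∷-injectiveˡ; ∷ʳ-injective; ++-assoc; ++-identityʳ; ++-conicalˡ; ++-conicalʳ; length-++; length-map;
         map-++; map-∘; map-id-local; map-cong-local; map-injective; reverse-++; reverse-involutive; take++drop≡id)
import Data.List.Relation.Unary.All as All
open import Data.List.Relation.Unary.Any using (here; there)
open import Data.Nat using (ℕ; zero; suc; pred; _+_; _∸_; _≤_; _<_; _≮_; _⊔_; _≡ᵇ_; _<ᵇ_; _≤ᵇ_; z≤n; s≤s; >-nonZero)
open import Data.Nat.Properties
open import Data.Product using (_×_; _,_; proj₁; proj₂; ∃-syntax)
open import Data.Sum using (_⊎_; inj₁; inj₂; [_,_]′)
open import Data.Unit using (tt)
open import Function using (_∘′_)
open import Relation.Binary.Definitions using (tri<; tri≈; tri>)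
open import Relation.Binary.PropositionalEquality hiding ([_])
open import Relation.Nullary using (yes; no)
open ≡-Reasoning

map-id-∈ : ∀ {f : ℕ → ℕ} xs → (∀ {a} → a ∈ xs → f a ≡ a) → map f xs ≡ xs
map-id-∈ xs fixed = map-id-local (All.tabulate fixed)

map-≢[] : ∀ (f : ℕ → ℕ) {xs} → xs ≢ [] → map f xs ≢ []
map-≢[] f {[]} xs≢[] = ⊥-elim (xs≢[] refl)
map-≢[] f {_ ∷ _} _ ()

++-injective : ∀ {A : Set} (xs xs′ : List A) {ys ys′} → length xs ≡ length xs′ →
  xs ++ ys ≡ xs′ ++ ys′ → xs ≡ xs′ × ys ≡ ys′
++-injective [] [] _ eq = refl , eq
++-injective (x ∷ xs) (x′ ∷ xs′) len eq with ∷-injective eq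
... | refl , eq′ = let (xs≡ , ys≡) = ++-injective xs xs′ (suc-injective len) eq′ in cong (x ∷_) xs≡ , ys≡

++-injective-suffix : ∀ {A : Set} (xs xs′ : List A) {ys ys′} → length ys ≡ length ys′ →
  xs ++ ys ≡ xs′ ++ ys′ → xs ≡ xs′ × ys ≡ ys′
++-injective-suffix xs xs′ {ys} {ys′} len eq = ++-injective xs xs′ (+-cancelʳ-≡ _ _ _ (begin
  length xs + length ys   ≡⟨ length-++ xs ⟨
  length (xs ++ ys)       ≡⟨ cong length eq ⟩
  length (xs′ ++ ys′)     ≡⟨ length-++ xs′ ⟩
  length xs′ + length ys′ ≡⟨ cong (length xs′ +_) len ⟨
  length xs′ + length ys  ∎)) eq

++-overlap : ∀ {A : Set} (xs ys xs′ ys′ : List A) → xs ++ ys ≡ xs′ ++ ys′ → length xs′ ≤ length xs →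
  ∃[ zs ] xs ≡ xs′ ++ zs × ys′ ≡ zs ++ ys
++-overlap xs ys [] ys′ eq _ = xs , refl , sym eq
++-overlap (x ∷ xs) ys (x′ ∷ xs′) ys′ eq (s≤s len) with ∷-injective eq
... | refl , eq′ = let (zs , xs≡ , ys′≡) = ++-overlap xs ys xs′ ys′ eq′ len in zs , cong (x ∷_) xs≡ , ys′≡

map-≡-++ : ∀ (f : ℕ → ℕ) xs ys zs → map f xs ≡ ys ++ zs →
  ∃[ xs₁ ] ∃[ xs₂ ] xs ≡ xs₁ ++ xs₂ × map f xs₁ ≡ ys × map f xs₂ ≡ zs
map-≡-++ f xs [] zs eq = [] , xs , refl , refl , eq
map-≡-++ f (x ∷ xs) (y ∷ ys) zs eq with ∷-injective eq
... | fx≡y , eq′ = let (xs₁ , xs₂ , xs≡ , f₁ , f₂) = map-≡-++ f xs ys zs eq′ in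
  x ∷ xs₁ , xs₂ , cong (x ∷_) xs≡ , cong₂ _∷_ fx≡y f₁ , f₂

take-length-++ : ∀ (A B : Word) → take (length A) (A ++ B) ≡ A
take-length-++ [] B = refl
take-length-++ (a ∷ A) B = cong (a ∷_) (take-length-++ A B)

drop-length-++ : ∀ (A B : Word) → drop (length A) (A ++ B) ≡ B
drop-length-++ [] B = refl
drop-length-++ (a ∷ A) B = drop-length-++ A B

length-∷ʳ : ∀ (xs : Word) x → length (xs ∷ʳ x) ≡ suc (length xs)
length-∷ʳ xs x = trans (length-++ xs) (+-comm (length xs) 1)

≢[]⇒length-positive : ∀ {w : Word} → w ≢ [] → 1 ≤ length w
≢[]⇒length-positive {[]} w≢[] = ⊥-elim (w≢[] refl)
≢[]⇒length-positive {_ ∷ _} _ = s≤s z≤n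

length-positive⇒≢[] : ∀ {w : Word} → 1 ≤ length w → w ≢ []
length-positive⇒≢[] 1≤ refl = 1+n≰n 1≤

+-length-≤⇒[] : ∀ n {a : Word} → n + length a ≤ n → a ≡ []
+-length-≤⇒[] n {[]} _ = refl
+-length-≤⇒[] n {_ ∷ a} n+|a|≤n = ⊥-elim (<⇒≱ (m<m+n n (s≤s z≤n)) n+|a|≤n)

length-+-≡1⇒[] : ∀ {y z : Word} → z ≢ [] → length y + length z ≡ 1 → y ≡ []
length-+-≡1⇒[] {[]} _ _ = refl
length-+-≡1⇒[] {_ ∷ _} {[]} z≢[] _ = ⊥-elim (z≢[] refl)
length-+-≡1⇒[] {_ ∷ y} {_ ∷ z} _ eq = ⊥-elim (1+n≢0 (trans (sym (+-suc (length y) (length z))) (suc-injective eq)))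

map-≡-++-∷ʳ : ∀ (f : ℕ → ℕ) xs ys zs {z} → map f xs ≡ ys ++ zs ++ [ z ] →
  ∃[ xs₁ ] ∃[ xs₂ ] ∃[ x ] xs ≡ xs₁ ++ xs₂ ++ [ x ] × map f xs₁ ≡ ys × map f xs₂ ≡ zs × f x ≡ z
map-≡-++-∷ʳ f xs ys zs eq with map-≡-++ f xs ys (zs ++ _) eq
... | xs₁ , rest , xs≡ , f₁ , f-rest with map-≡-++ f rest zs _ f-rest
...   | xs₂ , x ∷ [] , rest≡ , f₂ , fx = xs₁ , xs₂ , x , trans xs≡ (cong (xs₁ ++_) rest≡) , f₁ , f₂ , ∷-injectiveˡ fx

++-≡-∷ʳ-overlap : ∀ (A B C Y : Word) {ℓ} → A ++ B ≡ C ++ Y ++ [ ℓ ] → length C < length A → B ≢ [] →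
  ∃[ F ] B ≡ F ∷ʳ ℓ × (∀ {a} → a ∈ F → a ∈ Y) × ∃[ e ] e ∈ A × e ∈ Y
++-≡-∷ʳ-overlap A B C Y {ℓ} eq C<A B≢[] with ++-overlap A B C (Y ++ [ ℓ ]) eq (<⇒≤ C<A)
... | E , A≡CE , Yℓ≡EB with ++-overlap Y [ ℓ ] E B Yℓ≡EB E≤Y
  where
  E≤Y : length E ≤ length Y
  E≤Y = +-cancelʳ-≤ 1 _ _ (≤-trans (+-monoʳ-≤ (length E) (≢[]⇒length-positive B≢[]))
    (≤-reflexive (trans (sym (length-++ E)) (trans (cong length (sym Yℓ≡EB)) (length-++ Y)))))
... | F , Y≡EF , B≡Fℓ with E
...   | [] = ⊥-elim (<-irrefl (sym (trans (cong length A≡CE) (cong length (++-identityʳ C)))) C<A)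
...   | e ∷ E′ = F , B≡Fℓ , (λ a∈ → subst (_ ∈_) (sym Y≡EF) (∈-++⁺ʳ (e ∷ E′) a∈)) ,
  e , subst (e ∈_) (sym A≡CE) (∈-++⁺ʳ C (here refl)) , subst (e ∈_) (sym Y≡EF) (here refl)

pred< : ∀ {n} → 1 ≤ n → pred n < n
pred< {suc n} _ = ≤-refl

pred-+ : ∀ m {n} → 1 ≤ n → pred (m + n) ≡ m + pred n
pred-+ m {suc n} _ = cong pred (+-suc m n)

≤-maxW : ∀ {a} w → a ∈ w → a ≤ maxW w
≤-maxW (b ∷ w) (here refl) = m≤m⊔n b _
≤-maxW (b ∷ w) (there a∈w) = ≤-trans (≤-maxW w a∈w) (m≤n⊔m b _)

maxW-least : ∀ w {m} → (∀ {a} → a ∈ w → a ≤ m) → maxW w ≤ m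
maxW-least [] bound = z≤n
maxW-least (b ∷ w) bound = ⊔-lub (bound (here refl)) (maxW-least w (bound ∘′ there))

maxW-unique : ∀ w {B} → B ∈ w → (∀ {a} → a ∈ w → a ≤ B) → maxW w ≡ B
maxW-unique w B∈w bound = ≤-antisym (maxW-least w bound) (≤-maxW w B∈w)

maxW-∈ : ∀ w → w ≢ [] → maxW w ∈ w
maxW-∈ [] w≢[] = ⊥-elim (w≢[] refl)
maxW-∈ (b ∷ []) _ = here (⊔-identityʳ b)
maxW-∈ (b ∷ c ∷ w) _ =
  [ here , (λ eq → there (subst (_∈ c ∷ w) (sym eq) (maxW-∈ (c ∷ w) (λ ())))) ]′ (⊔-sel b (maxW (c ∷ w)))

maxW-<-least : ∀ w {c} → 0 < c → (∀ {a} → a ∈ w → a < c) → maxW w < c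
maxW-<-least [] 0<c _ = 0<c
maxW-<-least (a ∷ w) _ below = below (maxW-∈ (a ∷ w) (λ ()))

maxW-++ : ∀ xs ys → maxW (xs ++ ys) ≡ maxW xs ⊔ maxW ys
maxW-++ [] ys = refl
maxW-++ (x ∷ xs) ys = trans (cong (x ⊔_) (maxW-++ xs ys)) (sym (⊔-assoc x _ _))

maxW-shiftW : ∀ d u → maxW (shiftW d u) ⊔ d ≡ d + maxW u
maxW-shiftW d [] = sym (+-identityʳ d)
maxW-shiftW d (a ∷ u) = begin
  ((d + a) ⊔ maxW (shiftW d u)) ⊔ d ≡⟨ ⊔-assoc (d + a) _ d ⟩
  (d + a) ⊔ (maxW (shiftW d u) ⊔ d) ≡⟨ cong ((d + a) ⊔_) (maxW-shiftW d u) ⟩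
  (d + a) ⊔ (d + maxW u)             ≡⟨ +-distribˡ-⊔ d a (maxW u) ⟨
  d + (a ⊔ maxW u)                   ∎

maxW-⊙ : ∀ u v → maxW (u ⊙ v) ≡ maxW v + maxW u
maxW-⊙ u v = trans (maxW-++ (shiftW (maxW v) u) v) (maxW-shiftW (maxW v) u)

positive : ∀ {w a} → Packed w → a ∈ w → 1 ≤ a
positive P = proj₁ P _

packed-∈ : ∀ {w k} → Packed w → 1 ≤ k → k ≤ maxW w → k ∈ w
packed-∈ P = proj₂ P _

maxW-positive : ∀ {w} → Packed w → w ≢ [] → 1 ≤ maxW w
maxW-positive {w} P w≢[] = positive P (maxW-∈ w w≢[])

maxW-suc : ∀ {w} → Packed w → w ≢ [] → ∃[ m ] maxW w ≡ suc m
maxW-suc {w} P w≢[] with maxW w | maxW-positive P w≢[]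
... | suc m | _ = m , refl

packed-by-range : ∀ w B → (∀ {a} → a ∈ w → 1 ≤ a × a ≤ B) → (∀ {k} → 1 ≤ k → k ≤ B → k ∈ w) → Packed w
packed-by-range w B range onto =
  (λ a a∈w → proj₁ (range a∈w)) , (λ k 1≤k k≤max → onto 1≤k (≤-trans k≤max (maxW-least w (proj₂ ∘′ range))))

[1]-packed : Packed [ 1 ]
[1]-packed = (λ { _ (here refl) → s≤s z≤n }) , (λ { 1 _ _ → here refl ; (suc (suc _)) _ (s≤s ()) })

[1]≢[] : [ 1 ] ≢ []
[1]≢[] ()

shiftW-above : ∀ {d k u} → (∀ {a} → a ∈ u → 1 ≤ a) → k ∈ shiftW d u → d < k
shiftW-above {d} pos k∈ with ∈-map⁻ (d +_) k∈
... | a , a∈u , refl = m<m+n d (pos a∈u)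

∈-shiftW⁻ : ∀ {d k u} → Packed u → k ∈ shiftW d u → d < k × k ≤ d + maxW u
∈-shiftW⁻ {d} {u = u} P k∈ with ∈-map⁻ (d +_) k∈
... | a , a∈u , refl = shiftW-above (positive P) k∈ , +-monoʳ-≤ d (≤-maxW u a∈u)

∈-shiftW⁺ : ∀ {d k u} → Packed u → d < k → k ≤ d + maxW u → k ∈ shiftW d u
∈-shiftW⁺ {d} {k} {u} P d<k k≤ = subst (_∈ shiftW d u) (m+[n∸m]≡n (<⇒≤ d<k))
  (∈-map⁺ (d +_) (packed-∈ P (m<n⇒0<n∸m d<k) (subst (k ∸ d ≤_) (m+n∸m≡n d (maxW u)) (∸-monoˡ-≤ d k≤))))

shiftW-shiftW : ∀ d e xs → shiftW d (shiftW e xs) ≡ shiftW (d + e) xs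
shiftW-shiftW d e xs = trans (sym (map-∘ xs)) (map-cong-local (All.tabulate (λ {a} _ → sym (+-assoc d e a))))

shiftW-injective : ∀ d {xs ys} → shiftW d xs ≡ shiftW d ys → xs ≡ ys
shiftW-injective d = map-injective (+-cancelˡ-≡ d _ _)

replace : ℕ → ℕ → ℕ → ℕ
replace m t a = if a ≡ᵇ m then t else a

replaceW : ℕ → ℕ → Word → Word
replaceW m t = map (replace m t)

replace-cases : ∀ m t a → (a ≡ m × replace m t a ≡ t) ⊎ (a ≢ m × replace m t a ≡ a)
replace-cases m t a with a ≡ᵇ m in eq
... | true  = inj₁ (≡ᵇ⇒≡ a m (subst T (sym eq) tt) , refl)
... | false = inj₂ ((λ a≡m → subst T eq (≡⇒≡ᵇ a m a≡m)) , refl)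

replace-≡ : ∀ m t → replace m t m ≡ t
replace-≡ m t with replace-cases m t m
... | inj₁ (_ , r) = r
... | inj₂ (m≢m , _) = ⊥-elim (m≢m refl)

replace-≢ : ∀ {m a} t → a ≢ m → replace m t a ≡ a
replace-≢ {m} {a} t a≢m with replace-cases m t a
... | inj₁ (a≡m , _) = ⊥-elim (a≢m a≡m)
... | inj₂ (_ , r) = r

replace-positive : ∀ m {t a} → 1 ≤ t → 1 ≤ a → 1 ≤ replace m t a
replace-positive m {t} {a} 1≤t 1≤a with replace-cases m t a
... | inj₁ (_ , r) = subst (1 ≤_) (sym r) 1≤t
... | inj₂ (_ , r) = subst (1 ≤_) (sym r) 1≤a

+-replace : ∀ d m t a → d + replace m t a ≡ replace (d + m) (d + t) (d + a)
+-replace d m t a with replace-cases m t a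
... | inj₁ (refl , r) = trans (cong (d +_) r) (sym (replace-≡ (d + m) (d + t)))
... | inj₂ (a≢m , r) = trans (cong (d +_) r) (sym (replace-≢ (d + t) (a≢m ∘′ +-cancelˡ-≡ d a m)))

<-replace⁻ : ∀ {b m t c} → b < m → b < replace m t c → b < c
<-replace⁻ {b} {m} {t} {c} b<m b<r with replace-cases m t c
... | inj₁ (refl , _) = b<m
... | inj₂ (_ , r) = subst (b <_) r b<r

shiftW-replaceW : ∀ d m t xs → shiftW d (replaceW m t xs) ≡ replaceW (d + m) (d + t) (shiftW d xs)
shiftW-replaceW d m t xs =
  trans (sym (map-∘ xs)) (trans (map-cong-local (All.tabulate (λ {a} _ → +-replace d m t a))) (map-∘ xs))

∈-replaceW⁻ : ∀ {m t k} v → k ∈ replaceW m t v → k ≡ t ⊎ (k ∈ v × k ≢ m)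
∈-replaceW⁻ {m} {t} v k∈ with ∈-map⁻ (replace m t) k∈
... | b , b∈v , refl with replace-cases m t b
...   | inj₁ (_ , r) = inj₁ r
...   | inj₂ (b≢m , r) = inj₂ (subst (_∈ v) (sym r) b∈v , subst (_≢ m) (sym r) b≢m)

∈-replaceW⁺ : ∀ {m t k v} → k ∈ v → k ≢ m → k ∈ replaceW m t v
∈-replaceW⁺ {m} {t} {k} {v} k∈v k≢m = subst (_∈ replaceW m t v) (replace-≢ t k≢m) (∈-map⁺ (replace m t) k∈v)

∈-replaceW-target : ∀ {m t v} → m ∈ v → t ∈ replaceW m t v
∈-replaceW-target {m} {t} {v} m∈v = subst (_∈ replaceW m t v) (replace-≡ m t) (∈-map⁺ (replace m t) m∈v)

replaceW-self : ∀ m v → replaceW m m v ≡ v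
replaceW-self m v = map-id-∈ v λ {a} _ → self a
  where
  self : ∀ a → replace m m a ≡ a
  self a with replace-cases m m a
  ... | inj₁ (a≡m , r) = trans r (sym a≡m)
  ... | inj₂ (_ , r) = r

replaceW-fresh : ∀ {m} t v → (∀ {a} → a ∈ v → a ≢ m) → replaceW m t v ≡ v
replaceW-fresh t v fresh = map-id-∈ v (λ a∈v → replace-≢ t (fresh a∈v))

replaceW-replaceW : ∀ {m m′} t v → m ≤ m′ → (∀ {a} → a ∈ v → a ≤ m) →
  replaceW m′ t (replaceW m m′ v) ≡ replaceW m t v
replaceW-replaceW {m} {m′} t v m≤m′ bound = trans (sym (map-∘ v)) (map-cong-local (All.tabulate compose))
  where
  compose : ∀ {a} → a ∈ v → replace m′ t (replace m m′ a) ≡ replace m t a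
  compose {a} a∈v with replace-cases m m′ a | replace-cases m t a
  ... | inj₁ (_ , r) | inj₁ (_ , r′) = trans (cong (replace m′ t) r) (trans (replace-≡ m′ t) (sym r′))
  ... | inj₂ (a≢m , r) | inj₂ (_ , r′) = trans (cong (replace m′ t) r)
    (trans (replace-≢ t (λ a≡m′ → <⇒≱ (≤∧≢⇒< (bound a∈v) a≢m) (subst (m ≤_) (sym a≡m′) m≤m′))) (sym r′))
  ... | inj₁ (a≡m , _) | inj₂ (a≢m , _) = ⊥-elim (a≢m a≡m)
  ... | inj₂ (a≢m , _) | inj₁ (a≡m , _) = ⊥-elim (a≢m a≡m)

replaceW-involutive : ∀ {m t} v → m ≤ t → (∀ {a} → a ∈ v → a ≤ m) → replaceW t m (replaceW m t v) ≡ v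
replaceW-involutive {m} {t} v m≤t bound = trans (replaceW-replaceW m v m≤t bound) (replaceW-self m v)

-- Explicit forms of the red and blue products

fill-replicate : ∀ c U I W → fill c (replicate (length U) false ++ I) (U ++ W) ≡ U ++ fill c I W
fill-replicate c [] I W = refl
fill-replicate c (a ∷ U) I W = cong (a ∷_) (fill-replicate c U I W)

fill-redMask : ∀ c m v → (∀ {a} → a ∈ v → a ≤ m) →
  fill c (map (λ a → a ≡ᵇ m) v) (removeBelow m v) ≡ replaceW m c v
fill-redMask c m [] _ = refl
fill-redMask c m (a ∷ v) bound with a ≡ᵇ m in eq₁ | a <ᵇ m in eq₂
... | true  | true  = ⊥-elim (<-irrefl (≡ᵇ⇒≡ a m (subst T (sym eq₁) tt)) (<ᵇ⇒< a m (subst T (sym eq₂) tt)))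
... | true  | false = cong (c ∷_) (fill-redMask c m v (bound ∘′ there))
... | false | true  = cong (a ∷_) (fill-redMask c m v (bound ∘′ there))
... | false | false = ⊥-elim (subst T eq₂ (<⇒<ᵇ (≤∧≢⇒< (bound (here refl)) (λ a≡m → subst T eq₁ (≡⇒≡ᵇ a m a≡m)))))

∈-removeBelow⁻ : ∀ m v {b} → b ∈ removeBelow m v → b < m
∈-removeBelow⁻ m (a ∷ v) b∈ with a <ᵇ m in eq
∈-removeBelow⁻ m (a ∷ v) (here refl) | true = <ᵇ⇒< a m (subst T (sym eq) tt)
∈-removeBelow⁻ m (a ∷ v) (there b∈)  | true = ∈-removeBelow⁻ m v b∈
∈-removeBelow⁻ m (a ∷ v) b∈          | false = ∈-removeBelow⁻ m v b∈

∈-removeBelow⁺ : ∀ m v {b} → b ∈ v → b < m → b ∈ removeBelow m v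
∈-removeBelow⁺ m (a ∷ v) b∈ b<m with a <ᵇ m in eq
∈-removeBelow⁺ m (a ∷ v) (here refl) b<m | true = here refl
∈-removeBelow⁺ m (a ∷ v) (there b∈)  b<m | true = there (∈-removeBelow⁺ m v b∈ b<m)
∈-removeBelow⁺ m (a ∷ v) (here refl) b<m | false = ⊥-elim (subst T eq (<⇒<ᵇ b<m))
∈-removeBelow⁺ m (a ∷ v) (there b∈)  b<m | false = ∈-removeBelow⁺ m v b∈ b<m

maxW-redRest : ∀ {v} → Packed v → v ≢ [] → maxW (redRest v) ≡ pred (maxW v)
maxW-redRest {v} P v≢[] with maxW-suc P v≢[]
... | m , max≡ = ≤-antisym
  (maxW-least (redRest v) (λ b∈ → <⇒≤pred (∈-removeBelow⁻ (maxW v) v b∈)))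
  (subst (_≤ maxW (redRest v)) (sym (cong pred max≡)) (below m refl))
  where
  below : ∀ k → k ≡ m → k ≤ maxW (redRest v)
  below zero _ = z≤n
  below (suc k) refl = ≤-maxW (redRest v) (∈-removeBelow⁺ (maxW v) v
    (packed-∈ P (s≤s z≤n) (≤-trans (n≤1+n (suc k)) (≤-reflexive (sym max≡))))
    (≤-reflexive (sym max≡)))

◁R-rep : ∀ u v → Packed v → v ≢ [] →
  u ◁R v ≡ shiftW (pred (maxW v)) u ++ replaceW (maxW v) (maxW u + maxW v) v
◁R-rep u v P v≢[] = begin
  fill c (replicate (length u) false ++ redMask v) (shiftW d u ++ redRest v)
    ≡⟨ cong (λ k → fill c (replicate k false ++ redMask v) (shiftW d u ++ redRest v)) (sym (length-map (d +_) u)) ⟩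
  fill c (replicate (length (shiftW d u)) false ++ redMask v) (shiftW d u ++ redRest v)
    ≡⟨ fill-replicate c (shiftW d u) (redMask v) (redRest v) ⟩
  shiftW d u ++ fill c (redMask v) (redRest v)
    ≡⟨ cong (shiftW d u ++_) (fill-redMask c (maxW v) v (≤-maxW v)) ⟩
  shiftW d u ++ replaceW (maxW v) c v
    ≡⟨ cong₂ (λ d′ c′ → shiftW d′ u ++ replaceW (maxW v) c′ v) d≡ c≡ ⟩
  shiftW (pred (maxW v)) u ++ replaceW (maxW v) (maxW u + maxW v) v ∎
  where
  d c : ℕ
  d = maxW (redRest v)
  c = suc (maxW (u ⊙ redRest v))
  d≡ : d ≡ pred (maxW v)
  d≡ = maxW-redRest P v≢[]
  c≡ : c ≡ maxW u + maxW v
  c≡ with maxW-suc P v≢[]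
  ... | m , max≡ = begin
    suc (maxW (u ⊙ redRest v)) ≡⟨ cong suc (maxW-⊙ u (redRest v)) ⟩
    suc (d + maxW u)           ≡⟨ cong (λ d′ → suc (d′ + maxW u)) (trans d≡ (cong pred max≡)) ⟩
    suc (m + maxW u)           ≡⟨ cong suc (+-comm m (maxW u)) ⟩
    suc (maxW u + m)           ≡⟨ +-suc (maxW u) m ⟨
    maxW u + suc m             ≡⟨ cong (maxW u +_) max≡ ⟨
    maxW u + maxW v            ∎

bump : ℕ → ℕ → ℕ
bump k a = if k ≤ᵇ a then suc a else a

bump-≥ : ∀ {k a} → k ≤ a → bump k a ≡ suc a
bump-≥ {k} {a} k≤a with k ≤ᵇ a in eq
... | true = refl
... | false = ⊥-elim (subst T eq (≤⇒≤ᵇ k≤a))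

bump-< : ∀ {k a} → a < k → bump k a ≡ a
bump-< {k} {a} a<k with k ≤ᵇ a in eq
... | true = ⊥-elim (<⇒≱ a<k (≤ᵇ⇒≤ k a (subst T (sym eq) tt)))
... | false = refl

decLetter-> : ∀ {i a} → i < suc a → decLetter i (suc a) ≡ a
decLetter-> {i} {a} i<1+a with i <ᵇ suc a in eq
... | true = refl
... | false = ⊥-elim (subst T eq (<⇒<ᵇ i<1+a))

decLetter-< : ∀ {i a} → a < i → decLetter i a ≡ a
decLetter-< {i} {zero} _ = refl
decLetter-< {i} {suc a} a<i with i <ᵇ suc a in eq
... | true = ⊥-elim (<-asym a<i (<ᵇ⇒< i (suc a) (subst T (sym eq) tt)))
... | false = refl

bump-decLetter : ∀ d i a → a ≢ i → bump (i + d) (d + decLetter i a) ≡ d + a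
bump-decLetter d i a a≢i with <-cmp a i
... | tri< a<i _ _ = begin
  bump (i + d) (d + decLetter i a) ≡⟨ cong (λ b → bump (i + d) (d + b)) (decLetter-< a<i) ⟩
  bump (i + d) (d + a)             ≡⟨ bump-< (subst (d + a <_) (+-comm d i) (+-monoʳ-< d a<i)) ⟩
  d + a                            ∎
... | tri≈ _ a≡i _ = ⊥-elim (a≢i a≡i)
bump-decLetter d i (suc a) _ | tri> _ _ i<1+a = begin
  bump (i + d) (d + decLetter i (suc a)) ≡⟨ cong (λ b → bump (i + d) (d + b)) (decLetter-> i<1+a) ⟩
  bump (i + d) (d + a)                   ≡⟨ bump-≥ (subst (_≤ d + a) (+-comm d i) (+-monoʳ-≤ d (≤-pred i<1+a))) ⟩
  suc (d + a)                            ≡⟨ +-suc d a ⟨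
  d + suc a                              ∎

any-≡ᵇ-false⇒≢ : ∀ i p → any (λ a → a ≡ᵇ i) p ≡ false → ∀ {a} → a ∈ p → a ≢ i
any-≡ᵇ-false⇒≢ i (b ∷ p) none a∈ a≡i with b ≡ᵇ i in eq
any-≡ᵇ-false⇒≢ i (b ∷ p) () a∈ a≡i | true
any-≡ᵇ-false⇒≢ i (b ∷ p) none (here refl) a≡i | false = subst T eq (≡⇒≡ᵇ b i a≡i)
any-≡ᵇ-false⇒≢ i (b ∷ p) none (there a∈) a≡i | false = any-≡ᵇ-false⇒≢ i p none a∈ a≡i

blueDecompSnoc : ℕ → Word → BlueDec
blueDecompSnoc i p = if any (λ a → a ≡ᵇ i) p then bdec false i p else bdec true i (map (decLetter i) p)

blueDecomp-∷ʳ : ∀ p i → blueDecomp (p ∷ʳ i) ≡ blueDecompSnoc i p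
blueDecomp-∷ʳ p i = subst (λ q → blueDecomp (p ∷ʳ i) ≡ blueDecompSnoc i q)
  (reverse-involutive p) (viaReverse (p ∷ʳ i) (reverse-++ p [ i ]))
  where
  viaReverse : ∀ v → reverse v ≡ i ∷ reverse p → blueDecomp v ≡ blueDecompSnoc i (reverse (reverse p))
  viaReverse v eq with reverse v
  viaReverse v refl | .(i ∷ reverse p) with any (λ a → a ≡ᵇ i) (reverse (reverse p))
  ... | true = refl
  ... | false = refl

applyBlueDec : Word → BlueDec → Word
applyBlueDec u (bdec α i v′) = ψ α (i + maxW u) (v′ ⊙ u)

◁B-applyBlueDec : ∀ u v → u ◁B v ≡ applyBlueDec u (blueDecomp v)
◁B-applyBlueDec u v with blueDecomp v
... | bdec α i v′ = refl

bump-shiftW-decLetter : ∀ d i p → (∀ {a} → a ∈ p → a ≢ i) →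
  map (bump (i + d)) (shiftW d (map (decLetter i) p)) ≡ shiftW d p
bump-shiftW-decLetter d i [] _ = refl
bump-shiftW-decLetter d i (a ∷ p) ≢i =
  cong₂ _∷_ (bump-decLetter d i a (≢i (here refl))) (bump-shiftW-decLetter d i p (≢i ∘′ there))

◁B-rep : ∀ u p i → 1 ≤ i → u ◁B (p ∷ʳ i) ≡ shiftW (maxW u) p ++ u ++ [ i + maxW u ]
◁B-rep u p i 1≤i = begin
  u ◁B (p ∷ʳ i)                          ≡⟨ ◁B-applyBlueDec u (p ∷ʳ i) ⟩
  applyBlueDec u (blueDecomp (p ∷ʳ i))   ≡⟨ cong (applyBlueDec u) (blueDecomp-∷ʳ p i) ⟩
  applyBlueDec u (blueDecompSnoc i p)    ≡⟨ byOccurrence ⟩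
  (shiftW (maxW u) p ++ u) ∷ʳ (i + maxW u) ≡⟨ ++-assoc (shiftW (maxW u) p) u [ i + maxW u ] ⟩
  shiftW (maxW u) p ++ u ++ [ i + maxW u ] ∎
  where
  μ : ℕ
  μ = maxW u
  -- If i does not occur in p, the ψ∘ case applies, and its bump undoes the decrement of p.
  byOccurrence : applyBlueDec u (blueDecompSnoc i p) ≡ (shiftW μ p ++ u) ∷ʳ (i + μ)
  byOccurrence with any (λ a → a ≡ᵇ i) p in occurs
  ... | true = refl
  ... | false = cong (_∷ʳ (i + μ)) (begin
    map (bump (i + μ)) (shiftW μ (map (decLetter i) p) ++ u)
      ≡⟨ map-++ (bump (i + μ)) (shiftW μ (map (decLetter i) p)) u ⟩
    map (bump (i + μ)) (shiftW μ (map (decLetter i) p)) ++ map (bump (i + μ)) u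
      ≡⟨ cong₂ _++_ (bump-shiftW-decLetter μ i p (any-≡ᵇ-false⇒≢ i p occurs))
                    (map-id-∈ u (λ a∈u → bump-< (≤-trans (s≤s (≤-maxW u a∈u)) (+-monoˡ-≤ μ 1≤i)))) ⟩
    shiftW μ p ++ u ∎)

⊙-packed : ∀ {u v} → Packed u → Packed v → Packed (u ⊙ v)
⊙-packed {u} {v} Pu Pv = packed-by-range (u ⊙ v) (maxW v + maxW u) range onto
  where
  range : ∀ {a} → a ∈ u ⊙ v → 1 ≤ a × a ≤ maxW v + maxW u
  range a∈ with ∈-++⁻ (shiftW (maxW v) u) a∈
  ... | inj₁ a∈sh = let (v<a , a≤) = ∈-shiftW⁻ Pu a∈sh in ≤-trans (s≤s z≤n) v<a , a≤
  ... | inj₂ a∈v = positive Pv a∈v , ≤-trans (≤-maxW v a∈v) (m≤m+n (maxW v) (maxW u))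
  onto : ∀ {k} → 1 ≤ k → k ≤ maxW v + maxW u → k ∈ u ⊙ v
  onto {k} 1≤k k≤ with k ≤? maxW v
  ... | yes k≤v = ∈-++⁺ʳ (shiftW (maxW v) u) (packed-∈ Pv 1≤k k≤v)
  ... | no k≰v = ∈-++⁺ˡ (∈-shiftW⁺ Pu (≰⇒> k≰v) k≤)

◁R-packed-maxW : ∀ {u v} → Packed u → Packed v → v ≢ [] →
  Packed (u ◁R v) × maxW (u ◁R v) ≡ maxW u + maxW v
◁R-packed-maxW {u} {v} Pu Pv v≢[] with maxW-suc Pv v≢[]
... | m , max≡ rewrite ◁R-rep u v Pv v≢[] = subst PackedWithTop (sym max≡)
  (packed-by-range W M range onto , maxW-unique W (onto (≤-trans (s≤s z≤n) m<M) ≤-refl) (proj₂ ∘′ range))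
  where
  PackedWithTop : ℕ → Set
  PackedWithTop μ = let W′ = shiftW (pred μ) u ++ replaceW μ (maxW u + μ) v in Packed W′ × maxW W′ ≡ maxW u + μ
  M : ℕ
  M = maxW u + suc m
  W : Word
  W = shiftW m u ++ replaceW (suc m) M v
  m<M : m < M
  m<M = m≤n+m (suc m) (maxW u)
  range : ∀ {a} → a ∈ W → 1 ≤ a × a ≤ M
  range a∈ with ∈-++⁻ (shiftW m u) a∈
  ... | inj₁ a∈sh = let (m<a , a≤) = ∈-shiftW⁻ Pu a∈sh in
    ≤-trans (s≤s z≤n) m<a , ≤-trans a≤ (≤-trans (≤-reflexive (+-comm m (maxW u))) (+-monoʳ-≤ (maxW u) (n≤1+n m)))
  ... | inj₂ a∈rep with ∈-replaceW⁻ v a∈rep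
  ...   | inj₁ refl = ≤-trans (s≤s z≤n) m<M , ≤-refl
  ...   | inj₂ (a∈v , _) = positive Pv a∈v , ≤-trans (subst (_ ≤_) max≡ (≤-maxW v a∈v)) m<M
  onto : ∀ {k} → 1 ≤ k → k ≤ M → k ∈ W
  onto {k} 1≤k k≤M with k ≟ M | k ≤? m
  ... | yes refl | _ = ∈-++⁺ʳ (shiftW m u) (∈-replaceW-target (subst (_∈ v) max≡ (maxW-∈ v v≢[])))
  ... | no _ | yes k≤m = ∈-++⁺ʳ (shiftW m u)
    (∈-replaceW⁺ (packed-∈ Pv 1≤k (≤-trans k≤m (≤-trans (n≤1+n m) (≤-reflexive (sym max≡))))) (λ k≡ → 1+n≰n (subst (_≤ m) k≡ k≤m)))
  ... | no k≢M | no k≰m = ∈-++⁺ˡ (∈-shiftW⁺ Pu (≰⇒> k≰m)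
    (≤-pred (subst (k <_) (trans (+-suc (maxW u) m) (cong suc (+-comm (maxW u) m))) (≤∧≢⇒< k≤M k≢M))))

◁B-packed-maxW : ∀ {u v} → Packed u → Packed v → v ≢ [] →
  Packed (u ◁B v) × maxW (u ◁B v) ≡ maxW u + maxW v
◁B-packed-maxW {u} {v} Pu Pv v≢[] with initLast v
... | [] = ⊥-elim (v≢[] refl)
... | p ∷ʳ′ i rewrite ◁B-rep u p i (positive Pv (∈-++⁺ʳ p (here refl))) =
  packed-by-range W M range onto , maxW-unique W (onto (≤-trans (maxW-positive Pv v≢[]) (m≤n+m _ _)) ≤-refl) (proj₂ ∘′ range)
  where
  i∈v : i ∈ p ∷ʳ i
  i∈v = ∈-++⁺ʳ p (here refl)
  μ M : ℕ
  μ = maxW u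
  M = μ + maxW (p ∷ʳ i)
  W : Word
  W = shiftW μ p ++ u ++ [ i + μ ]
  range : ∀ {a} → a ∈ W → 1 ≤ a × a ≤ M
  range a∈ with ∈-++⁻ (shiftW μ p) a∈
  ... | inj₁ a∈sh with ∈-map⁻ (μ +_) a∈sh
  ...   | b , b∈p , refl = ≤-trans (positive Pv (∈-++⁺ˡ b∈p)) (m≤n+m b μ) , +-monoʳ-≤ μ (≤-maxW (p ∷ʳ i) (∈-++⁺ˡ b∈p))
  range a∈ | inj₂ a∈rest with ∈-++⁻ u a∈rest
  ...   | inj₁ a∈u = positive Pu a∈u , ≤-trans (≤-maxW u a∈u) (m≤m+n μ _)
  ...   | inj₂ (here refl) = ≤-trans (positive Pv i∈v) (m≤m+n i μ) ,
                              subst (_≤ M) (+-comm μ i) (+-monoʳ-≤ μ (≤-maxW (p ∷ʳ i) i∈v))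
  onto : ∀ {k} → 1 ≤ k → k ≤ M → k ∈ W
  onto {k} 1≤k k≤M with k ≤? μ
  ... | yes k≤μ = ∈-++⁺ʳ (shiftW μ p) (∈-++⁺ˡ (packed-∈ Pu 1≤k k≤μ))
  ... | no k≰μ with ∈-++⁻ p (packed-∈ Pv (m<n⇒0<n∸m (≰⇒> k≰μ)) (subst (k ∸ μ ≤_) (m+n∸m≡n μ _) (∸-monoˡ-≤ μ k≤M)))
  ...   | inj₁ k∸μ∈p = ∈-++⁺ˡ (subst (_∈ shiftW μ p) (m+[n∸m]≡n (<⇒≤ (≰⇒> k≰μ))) (∈-map⁺ (μ +_) k∸μ∈p))
  ...   | inj₂ (here k∸μ≡i) = ∈-++⁺ʳ (shiftW μ p) (∈-++⁺ʳ u (here (begin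
    k           ≡⟨ m+[n∸m]≡n (<⇒≤ (≰⇒> k≰μ)) ⟨
    μ + (k ∸ μ) ≡⟨ cong (μ +_) k∸μ≡i ⟩
    μ + i       ≡⟨ +-comm μ i ⟩
    i + μ       ∎)))

◁R-packed : ∀ {u v} → Packed u → Packed v → v ≢ [] → Packed (u ◁R v)
◁R-packed Pu Pv v≢[] = proj₁ (◁R-packed-maxW Pu Pv v≢[])

maxW-◁R : ∀ {u v} → Packed u → Packed v → v ≢ [] → maxW (u ◁R v) ≡ maxW u + maxW v
maxW-◁R Pu Pv v≢[] = proj₂ (◁R-packed-maxW Pu Pv v≢[])

◁B-packed : ∀ {u v} → Packed u → Packed v → v ≢ [] → Packed (u ◁B v)
◁B-packed Pu Pv v≢[] = proj₁ (◁B-packed-maxW Pu Pv v≢[])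

maxW-◁B : ∀ {u v} → Packed u → Packed v → v ≢ [] → maxW (u ◁B v) ≡ maxW u + maxW v
maxW-◁B Pu Pv v≢[] = proj₂ (◁B-packed-maxW Pu Pv v≢[])

length-⊙ : ∀ u v → length (u ⊙ v) ≡ length u + length v
length-⊙ u v = trans (length-++ (shiftW (maxW v) u)) (cong (_+ length v) (length-map _ u))

length-◁R : ∀ u {v} → Packed v → v ≢ [] → length (u ◁R v) ≡ length u + length v
length-◁R u {v} Pv v≢[] rewrite ◁R-rep u v Pv v≢[] | length-++ (shiftW (pred (maxW v)) u) {replaceW (maxW v) (maxW u + maxW v) v}
  | length-map (pred (maxW v) +_) u | length-map (replace (maxW v) (maxW u + maxW v)) v = refl

length-◁B : ∀ u {v} → Packed v → v ≢ [] → length (u ◁B v) ≡ length u + length v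
length-◁B u {v} Pv v≢[] with initLast v
... | [] = ⊥-elim (v≢[] refl)
... | p ∷ʳ′ i rewrite ◁B-rep u p i (positive Pv (∈-++⁺ʳ p (here refl))) = begin
  length (shiftW (maxW u) p ++ u ++ [ i + maxW u ])    ≡⟨ length-++ (shiftW (maxW u) p) ⟩
  length (shiftW (maxW u) p) + length (u ∷ʳ (i + maxW u)) ≡⟨ cong₂ _+_ (length-map _ p) (length-∷ʳ u _) ⟩
  length p + suc (length u)                           ≡⟨ +-suc (length p) (length u) ⟩
  suc (length p) + length u                           ≡⟨ +-comm (suc (length p)) (length u) ⟩
  length u + suc (length p)                           ≡⟨ cong (length u +_) (length-∷ʳ p i) ⟨
  length u + length (p ∷ʳ i)                          ∎

◁R-≢[] : ∀ u {v} → Packed v → v ≢ [] → u ◁R v ≢ []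
◁R-≢[] u Pv v≢[] = length-positive⇒≢[] (subst (1 ≤_) (sym (length-◁R u Pv v≢[]))
  (≤-trans (≢[]⇒length-positive v≢[]) (m≤n+m _ (length u))))

◁B-≢[] : ∀ u {v} → Packed v → v ≢ [] → u ◁B v ≢ []
◁B-≢[] u Pv v≢[] = length-positive⇒≢[] (subst (1 ≤_) (sym (length-◁B u Pv v≢[]))
  (≤-trans (≢[]⇒length-positive v≢[]) (m≤n+m _ (length u))))

[]-◁R : ∀ {v} → Packed v → v ≢ [] → [] ◁R v ≡ v
[]-◁R {v} Pv v≢[] = trans (◁R-rep [] v Pv v≢[]) (replaceW-self (maxW v) v)

[]-◁B : ∀ {v} → Packed v → v ≢ [] → [] ◁B v ≡ v
[]-◁B {v} Pv v≢[] with initLast v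
... | [] = ⊥-elim (v≢[] refl)
... | p ∷ʳ′ i = trans (◁B-rep [] p i (positive Pv (∈-++⁺ʳ p (here refl))))
  (cong₂ (λ q j → q ++ [ j ]) (map-id-∈ p (λ _ → refl)) (+-identityʳ i))

◁R-[1] : ∀ w → w ◁R [ 1 ] ≡ w ∷ʳ suc (maxW w)
◁R-[1] w = trans (◁R-rep w [ 1 ] [1]-packed [1]≢[])
  (cong₂ (λ q j → q ∷ʳ j) (map-id-∈ w (λ _ → refl)) (trans (replace-≡ 1 (maxW w + 1)) (+-comm (maxW w) 1)))

◁B-[1] : ∀ w → w ◁B [ 1 ] ≡ w ∷ʳ suc (maxW w)
◁B-[1] w = ◁B-rep w [] 1 (s≤s z≤n)

◁R-≡[1] : ∀ {y z} → Packed z → z ≢ [] → y ◁R z ≡ [ 1 ] → y ≡ [] × z ≡ [ 1 ]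
◁R-≡[1] {y} {z} Pz z≢[] eq = y≡[] , trans (sym ([]-◁R Pz z≢[])) (trans (cong (_◁R z) (sym y≡[])) eq)
  where
  y≡[] : y ≡ []
  y≡[] = length-+-≡1⇒[] z≢[] (trans (sym (length-◁R y Pz z≢[])) (cong length eq))

◁B-≡[1] : ∀ {y z} → Packed z → z ≢ [] → y ◁B z ≡ [ 1 ] → y ≡ [] × z ≡ [ 1 ]
◁B-≡[1] {y} {z} Pz z≢[] eq = y≡[] , trans (sym ([]-◁B Pz z≢[])) (trans (cong (_◁B z) (sym y≡[])) eq)
  where
  y≡[] : y ≡ []
  y≡[] = length-+-≡1⇒[] z≢[] (trans (sym (length-◁B y Pz z≢[])) (cong length eq))

-- Cancellation

◁B-cancel : ∀ {a b c d} → Packed b → b ≢ [] → Packed d → d ≢ [] →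
  a ◁B b ≡ c ◁B d → length a ≡ length c → a ≡ c × b ≡ d
◁B-cancel {a} {b} {c} {d} Pb b≢[] Pd d≢[] eq len with initLast b | initLast d
... | [] | _ = ⊥-elim (b≢[] refl)
... | _ | [] = ⊥-elim (d≢[] refl)
... | p ∷ʳ′ i | q ∷ʳ′ j with ∷ʳ-injective (shiftW (maxW a) p ++ a) (shiftW (maxW c) q ++ c) (begin
  (shiftW (maxW a) p ++ a) ∷ʳ (i + maxW a) ≡⟨ ++-assoc (shiftW (maxW a) p) a _ ⟩
  shiftW (maxW a) p ++ a ++ [ i + maxW a ] ≡⟨ ◁B-rep a p i (positive Pb (∈-++⁺ʳ p (here refl))) ⟨
  a ◁B (p ∷ʳ i)                            ≡⟨ eq ⟩
  c ◁B (q ∷ʳ j)                            ≡⟨ ◁B-rep c q j (positive Pd (∈-++⁺ʳ q (here refl))) ⟩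
  shiftW (maxW c) q ++ c ++ [ j + maxW c ] ≡⟨ ++-assoc (shiftW (maxW c) q) c _ ⟨
  (shiftW (maxW c) q ++ c) ∷ʳ (j + maxW c) ∎)
... | init≡ , last≡ with ++-injective-suffix (shiftW (maxW a) p) (shiftW (maxW c) q) len init≡
... | shifted≡ , refl = refl , cong₂ _∷ʳ_ (shiftW-injective (maxW a) shifted≡) (+-cancelʳ-≡ (maxW a) i j last≡)

-- If max b < max d, the letter max d − 1 lies in the image of d but not in that of b.
replaceW-max-≮ : ∀ {b d t} → Packed b → b ≢ [] → Packed d → d ≢ [] → maxW d ≤ t →
  replaceW (maxW b) t b ≡ replaceW (maxW d) t d → maxW b ≮ maxW d
replaceW-max-≮ {b} {d} {t} Pb b≢[] Pd d≢[] md≤t eq mb<md with maxW-suc Pd d≢[]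
... | k , md≡ with ∈-replaceW⁻ b (subst (k ∈_) (sym eq) (∈-replaceW⁺ k∈d (λ k≡ → 1+n≰n (≤-reflexive (trans (sym md≡) (sym k≡))))))
  where
  mb≤k : maxW b ≤ k
  mb≤k = ≤-pred (subst (maxW b <_) md≡ mb<md)
  k∈d : k ∈ d
  k∈d = packed-∈ Pd (≤-trans (maxW-positive Pb b≢[]) mb≤k) (subst (k ≤_) (sym md≡) (n≤1+n k))
... | inj₁ k≡t = 1+n≰n (≤-trans (≤-reflexive (sym md≡)) (subst (maxW d ≤_) (sym k≡t) md≤t))
... | inj₂ (k∈b , k≢mb) = <⇒≱ (≤∧≢⇒< (≤-maxW b k∈b) k≢mb) (≤-pred (subst (maxW b <_) md≡ mb<md))

◁R-cancel : ∀ {a b c d} → Packed a → Packed b → b ≢ [] → Packed c → Packed d → d ≢ [] →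
  a ◁R b ≡ c ◁R d → length a ≡ length c → a ≡ c × b ≡ d
◁R-cancel {a} {b} {c} {d} Pa Pb b≢[] Pc Pd d≢[] eq len with ++-injective
  (shiftW (pred (maxW b)) a) (shiftW (pred (maxW d)) c)
  (trans (length-map _ a) (trans len (sym (length-map _ c))))
  (trans (sym (◁R-rep a b Pb b≢[])) (trans eq (◁R-rep c d Pd d≢[])))
... | shifted≡ , replaced≡ = a≡c , b≡d
  where
  tops≡ : maxW a + maxW b ≡ maxW c + maxW d
  tops≡ = trans (sym (maxW-◁R Pa Pb b≢[])) (trans (cong maxW eq) (maxW-◁R Pc Pd d≢[]))
  replaced≡′ : replaceW (maxW b) (maxW a + maxW b) b ≡ replaceW (maxW d) (maxW a + maxW b) d
  replaced≡′ = trans replaced≡ (cong (λ t → replaceW (maxW d) t d) (sym tops≡))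
  maxs≡ : maxW b ≡ maxW d
  maxs≡ = ≤-antisym
    (≮⇒≥ (replaceW-max-≮ Pd d≢[] Pb b≢[] (m≤n+m (maxW b) (maxW a)) (sym replaced≡′)))
    (≮⇒≥ (replaceW-max-≮ Pb b≢[] Pd d≢[] (subst (maxW d ≤_) (sym tops≡) (m≤n+m (maxW d) (maxW c))) replaced≡′))
  a≡c : a ≡ c
  a≡c = shiftW-injective (pred (maxW b)) (trans shifted≡ (cong (λ m → shiftW (pred m) c) (sym maxs≡)))
  b≡d : b ≡ d
  b≡d = begin
    b                                                                     ≡⟨ replaceW-involutive b (m≤n+m _ _) (≤-maxW b) ⟨
    replaceW (maxW a + maxW b) (maxW b) (replaceW (maxW b) (maxW a + maxW b) b) ≡⟨ cong (replaceW (maxW a + maxW b) (maxW b)) replaced≡′ ⟩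
    replaceW (maxW a + maxW b) (maxW b) (replaceW (maxW d) (maxW a + maxW b) d) ≡⟨ cong (λ m → replaceW (maxW a + maxW b) m (replaceW (maxW d) (maxW a + maxW b) d)) maxs≡ ⟩
    replaceW (maxW a + maxW b) (maxW d) (replaceW (maxW d) (maxW a + maxW b) d) ≡⟨ replaceW-involutive d (subst (_≤ maxW a + maxW b) maxs≡ (m≤n+m _ _)) (≤-maxW d) ⟩
    d                                                                     ∎

-- Associativity and commutation

◁R-assoc : ∀ {x a c} → Packed x → Packed a → Packed c → c ≢ [] → x ◁R (a ◁R c) ≡ (x ⊙ a) ◁R c
◁R-assoc {x} {a} {c} Px Pa Pc c≢[] = begin
  x ◁R (a ◁R c)
    ≡⟨ ◁R-rep x (a ◁R c) (◁R-packed Pa Pc c≢[]) (◁R-≢[] a Pc c≢[]) ⟩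
  shiftW (pred (maxW (a ◁R c))) x ++ replaceW (maxW (a ◁R c)) (mx + maxW (a ◁R c)) (a ◁R c)
    ≡⟨ cong (λ M → shiftW (pred M) x ++ replaceW M (mx + M) (a ◁R c)) (maxW-◁R Pa Pc c≢[]) ⟩
  shiftW (pred (ma + mc)) x ++ replaceW (ma + mc) t₀ (a ◁R c)
    ≡⟨ cong (λ V → shiftW (pred (ma + mc)) x ++ replaceW (ma + mc) t₀ V) (◁R-rep a c Pc c≢[]) ⟩
  shiftW (pred (ma + mc)) x ++ replaceW (ma + mc) t₀ (shiftW (pred mc) a ++ replaceW mc (ma + mc) c)
    ≡⟨ cong (shiftW (pred (ma + mc)) x ++_) (map-++ (replace (ma + mc) t₀) (shiftW (pred mc) a) _) ⟩
  shiftW (pred (ma + mc)) x ++ replaceW (ma + mc) t₀ (shiftW (pred mc) a) ++ replaceW (ma + mc) t₀ (replaceW mc (ma + mc) c)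
    ≡⟨ cong (shiftW (pred (ma + mc)) x ++_) (cong₂ _++_
         (replaceW-fresh t₀ (shiftW (pred mc) a) (λ b∈ → <⇒≢ (shifted<top b∈)))
         (replaceW-replaceW t₀ c (m≤n+m mc ma) (≤-maxW c))) ⟩
  shiftW (pred (ma + mc)) x ++ shiftW (pred mc) a ++ replaceW mc t₀ c
    ≡⟨ ++-assoc (shiftW (pred (ma + mc)) x) _ _ ⟨
  (shiftW (pred (ma + mc)) x ++ shiftW (pred mc) a) ++ replaceW mc t₀ c
    ≡⟨ cong (λ s → (s ++ shiftW (pred mc) a) ++ replaceW mc t₀ c) shift≡ ⟩
  (shiftW (pred mc) (shiftW ma x) ++ shiftW (pred mc) a) ++ replaceW mc t₀ c
    ≡⟨ cong (_++ replaceW mc t₀ c) (map-++ (pred mc +_) (shiftW ma x) a) ⟨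
  shiftW (pred mc) (x ⊙ a) ++ replaceW mc t₀ c
    ≡⟨ cong (λ t → shiftW (pred mc) (x ⊙ a) ++ replaceW mc t c) top≡ ⟩
  shiftW (pred mc) (x ⊙ a) ++ replaceW mc (maxW (x ⊙ a) + mc) c
    ≡⟨ ◁R-rep (x ⊙ a) c Pc c≢[] ⟨
  (x ⊙ a) ◁R c ∎
  where
  mx ma mc t₀ : ℕ
  mx = maxW x
  ma = maxW a
  mc = maxW c
  t₀ = mx + (ma + mc)
  1≤mc : 1 ≤ mc
  1≤mc = maxW-positive Pc c≢[]
  shifted<top : ∀ {b} → b ∈ shiftW (pred mc) a → b < ma + mc
  shifted<top b∈ = let (_ , b≤) = ∈-shiftW⁻ Pa b∈ in
    ≤-<-trans b≤ (subst (pred mc + ma <_) (+-comm mc ma) (+-monoˡ-< ma (pred< 1≤mc)))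
  shift≡ : shiftW (pred (ma + mc)) x ≡ shiftW (pred mc) (shiftW ma x)
  shift≡ = trans (cong (λ d → shiftW d x) (trans (pred-+ ma 1≤mc) (+-comm ma (pred mc)))) (sym (shiftW-shiftW (pred mc) ma x))
  top≡ : t₀ ≡ maxW (x ⊙ a) + mc
  top≡ = trans (sym (+-assoc mx ma mc)) (cong (_+ mc) (trans (+-comm mx ma) (sym (maxW-⊙ x a))))

◁B-assoc : ∀ {y b c} → Packed c → c ≢ [] → y ◁B (b ◁B c) ≡ (b ⊙ y) ◁B c
◁B-assoc {y} {b} {c} Pc c≢[] with initLast c
... | [] = ⊥-elim (c≢[] refl)
... | p ∷ʳ′ i = begin
  y ◁B (b ◁B (p ∷ʳ i))
    ≡⟨ cong (y ◁B_) (trans (◁B-rep b p i 1≤i) (sym (++-assoc (shiftW mb p) b _))) ⟩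
  y ◁B ((shiftW mb p ++ b) ∷ʳ (i + mb))
    ≡⟨ ◁B-rep y (shiftW mb p ++ b) (i + mb) (≤-trans 1≤i (m≤m+n i mb)) ⟩
  shiftW my (shiftW mb p ++ b) ++ y ++ [ i + mb + my ]
    ≡⟨ cong (_++ y ++ [ i + mb + my ]) (map-++ (my +_) (shiftW mb p) b) ⟩
  (shiftW my (shiftW mb p) ++ shiftW my b) ++ y ++ [ i + mb + my ]
    ≡⟨ ++-assoc (shiftW my (shiftW mb p)) (shiftW my b) _ ⟩
  shiftW my (shiftW mb p) ++ shiftW my b ++ y ++ [ i + mb + my ]
    ≡⟨ cong₂ (λ s j → s ++ shiftW my b ++ y ++ [ j ]) (shiftW-shiftW my mb p) (trans (+-assoc i mb my) (cong (i +_) (+-comm mb my))) ⟩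
  shiftW (my + mb) p ++ shiftW my b ++ y ++ [ i + (my + mb) ]
    ≡⟨ cong (shiftW (my + mb) p ++_) (sym (++-assoc (shiftW my b) y _)) ⟩
  shiftW (my + mb) p ++ (b ⊙ y) ++ [ i + (my + mb) ]
    ≡⟨ cong (λ M → shiftW M p ++ (b ⊙ y) ++ [ i + M ]) (sym (maxW-⊙ b y)) ⟩
  shiftW (maxW (b ⊙ y)) p ++ (b ⊙ y) ++ [ i + maxW (b ⊙ y) ]
    ≡⟨ ◁B-rep (b ⊙ y) p i 1≤i ⟨
  (b ⊙ y) ◁B (p ∷ʳ i) ∎
  where
  1≤i : 1 ≤ i
  1≤i = positive Pc (∈-++⁺ʳ p (here refl))
  mb my : ℕ
  mb = maxW b
  my = maxW y

◁B-◁R-comm : ∀ {y a b} → Packed y → Packed a → Packed b → b ≢ [] → y ◁B (a ◁R b) ≡ a ◁R (y ◁B b)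
◁B-◁R-comm {y} {a} {b} Py Pa Pb b≢[] with initLast b
... | [] = ⊥-elim (b≢[] refl)
... | p ∷ʳ′ i = begin
  y ◁B (a ◁R (p ∷ʳ i))
    ≡⟨ cong (y ◁B_) redAsSnoc ⟩
  y ◁B ((shiftW (pred mb) a ++ replaceW mb t p) ∷ʳ replace mb t i)
    ≡⟨ ◁B-rep y (shiftW (pred mb) a ++ replaceW mb t p) (replace mb t i) (replace-positive mb (≤-trans 1≤mb (m≤n+m mb ma)) 1≤i) ⟩
  shiftW my (shiftW (pred mb) a ++ replaceW mb t p) ++ y ++ [ replace mb t i + my ]
    ≡⟨ cong (_++ y ++ [ replace mb t i + my ]) (map-++ (my +_) (shiftW (pred mb) a) (replaceW mb t p)) ⟩
  (shiftW my (shiftW (pred mb) a) ++ shiftW my (replaceW mb t p)) ++ y ++ [ replace mb t i + my ]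
    ≡⟨ ++-assoc (shiftW my (shiftW (pred mb) a)) _ _ ⟩
  shiftW my (shiftW (pred mb) a) ++ shiftW my (replaceW mb t p) ++ y ++ [ replace mb t i + my ]
    ≡⟨ cong₂ _++_ shiftA (cong₂ _++_ shiftP (cong₂ _++_ (sym freshY) (cong [_] lastLetter))) ⟩
  shiftW (pred M) a ++ replaceW M t′ (shiftW my p) ++ replaceW M t′ y ++ [ replace M t′ (i + my) ]
    ≡⟨ cong (λ s → shiftW (pred M) a ++ s) (sym (trans (map-++ (replace M t′) (shiftW my p) _)
         (cong (replaceW M t′ (shiftW my p) ++_) (map-++ (replace M t′) y _)))) ⟩
  shiftW (pred M) a ++ replaceW M t′ (shiftW my p ++ y ++ [ i + my ])
    ≡⟨ cong (λ V → shiftW (pred M) a ++ replaceW M t′ V) (◁B-rep y p i 1≤i) ⟨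
  shiftW (pred M) a ++ replaceW M t′ (y ◁B (p ∷ʳ i))
    ≡⟨ cong (λ M′ → shiftW (pred M′) a ++ replaceW M′ (ma + M′) (y ◁B (p ∷ʳ i))) (maxW-◁B Py Pb b≢[]) ⟨
  shiftW (pred (maxW (y ◁B (p ∷ʳ i)))) a ++ replaceW (maxW (y ◁B (p ∷ʳ i))) (ma + maxW (y ◁B (p ∷ʳ i))) (y ◁B (p ∷ʳ i))
    ≡⟨ ◁R-rep a (y ◁B (p ∷ʳ i)) (◁B-packed Py Pb b≢[]) (◁B-≢[] y Pb b≢[]) ⟨
  a ◁R (y ◁B (p ∷ʳ i)) ∎
  where
  ma mb my t M t′ : ℕ
  ma = maxW a
  mb = maxW (p ∷ʳ i)
  my = maxW y
  t = ma + mb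
  M = my + mb
  t′ = ma + M
  1≤i : 1 ≤ i
  1≤i = positive Pb (∈-++⁺ʳ p (here refl))
  1≤mb : 1 ≤ mb
  1≤mb = maxW-positive Pb b≢[]
  my+t≡t′ : my + t ≡ t′
  my+t≡t′ = trans (sym (+-assoc my ma mb)) (trans (cong (_+ mb) (+-comm my ma)) (+-assoc ma my mb))
  redAsSnoc : a ◁R (p ∷ʳ i) ≡ (shiftW (pred mb) a ++ replaceW mb t p) ∷ʳ replace mb t i
  redAsSnoc = begin
    a ◁R (p ∷ʳ i)                                                ≡⟨ ◁R-rep a (p ∷ʳ i) Pb b≢[] ⟩
    shiftW (pred mb) a ++ replaceW mb t (p ∷ʳ i)                 ≡⟨ cong (shiftW (pred mb) a ++_) (map-++ (replace mb t) p [ i ]) ⟩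
    shiftW (pred mb) a ++ replaceW mb t p ∷ʳ replace mb t i      ≡⟨ ++-assoc (shiftW (pred mb) a) _ _ ⟨
    (shiftW (pred mb) a ++ replaceW mb t p) ∷ʳ replace mb t i    ∎
  shiftA : shiftW my (shiftW (pred mb) a) ≡ shiftW (pred M) a
  shiftA = trans (shiftW-shiftW my (pred mb) a) (cong (λ d → shiftW d a) (sym (pred-+ my 1≤mb)))
  shiftP : shiftW my (replaceW mb t p) ≡ replaceW M t′ (shiftW my p)
  shiftP = trans (shiftW-replaceW my mb t p) (cong (λ t″ → replaceW M t″ (shiftW my p)) my+t≡t′)
  freshY : replaceW M t′ y ≡ y
  freshY = replaceW-fresh t′ y (λ c∈y → <⇒≢ (≤-<-trans (≤-maxW y c∈y) (m<m+n my 1≤mb)))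
  lastLetter : replace mb t i + my ≡ replace M t′ (i + my)
  lastLetter = begin
    replace mb t i + my             ≡⟨ +-comm (replace mb t i) my ⟩
    my + replace mb t i             ≡⟨ +-replace my mb t i ⟩
    replace M (my + t) (my + i)     ≡⟨ cong₂ (replace M) my+t≡t′ (+-comm my i) ⟩
    replace M t′ (i + my)           ∎

-- Global descents

_≪_ : Word → Word → Set
Y ≪ Z = ∀ {b c} → b ∈ Y → c ∈ Z → b < c

GlobalDescentSplit : Word → Set
GlobalDescentSplit w = ∃[ A ] ∃[ B ] A ≢ [] × B ≢ [] × B ≪ A × w ≡ A ++ B

split⇒globalDescent : ∀ {w} → GlobalDescentSplit w → ∃[ c ] GlobalDescent w c
split⇒globalDescent (A , B , A≢[] , B≢[] , B≪A , refl) =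
  length A , ≢[]⇒length-positive A≢[] ,
  subst (length A <_) (sym (length-++ A)) (m<m+n (length A) (≢[]⇒length-positive B≢[])) ,
  λ a b a∈ b∈ → B≪A (subst (b ∈_) (drop-length-++ A B) b∈) (subst (a ∈_) (take-length-++ A B) a∈)

globalDescent⇒split : ∀ {w c} → GlobalDescent w c → GlobalDescentSplit w
globalDescent⇒split {w} {c} (1≤c , c<|w| , descent) =
  take c w , drop c w , take≢[] c w 1≤c c<|w| , drop≢[] c w c<|w| ,
  (λ b∈ a∈ → descent _ _ a∈ b∈) , sym (take++drop≡id c w)
  where
  take≢[] : ∀ c (z : Word) → 1 ≤ c → c < length z → take c z ≢ []
  take≢[] (suc c) (a ∷ z) _ _ ()
  drop≢[] : ∀ c (z : Word) → c < length z → drop c z ≢ []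
  drop≢[] zero (a ∷ z) _ ()
  drop≢[] (suc c) (a ∷ z) (s≤s c<) = drop≢[] c z c<

◁B-split : ∀ {y z} → Packed z → GlobalDescentSplit z → GlobalDescentSplit (y ◁B z)
◁B-split {y} Pz (A , B , A≢[] , B≢[] , B≪A , refl) with initLast B
... | [] = ⊥-elim (B≢[] refl)
... | B₀ ∷ʳ′ t = L , R , L≢[] , R≢[] , R≪L , (begin
  y ◁B (A ++ B₀ ∷ʳ t)                       ≡⟨ cong (y ◁B_) (++-assoc A B₀ [ t ]) ⟨
  y ◁B ((A ++ B₀) ∷ʳ t)                     ≡⟨ ◁B-rep y (A ++ B₀) t (positive Pz (∈-++⁺ʳ A (∈-++⁺ʳ B₀ (here refl)))) ⟩
  shiftW my (A ++ B₀) ++ y ++ [ t + my ]    ≡⟨ cong (_++ y ++ [ t + my ]) (map-++ (my +_) A B₀) ⟩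
  (L ++ shiftW my B₀) ++ y ++ [ t + my ]    ≡⟨ ++-assoc L (shiftW my B₀) _ ⟩
  L ++ R                                    ∎)
  where
  my : ℕ
  my = maxW y
  L R : Word
  L = shiftW my A
  R = shiftW my B₀ ++ y ++ [ t + my ]
  L≢[] : L ≢ []
  L≢[] = map-≢[] (my +_) A≢[]
  R≢[] : R ≢ []
  R≢[] eq with ++-conicalʳ y [ t + my ] (++-conicalʳ (shiftW my B₀) _ eq)
  ... | ()
  R≪L : R ≪ L
  R≪L r∈ l∈ with ∈-map⁻ (my +_) l∈
  ... | a , a∈A , refl with ∈-++⁻ (shiftW my B₀) r∈
  ...   | inj₁ r∈sh with ∈-map⁻ (my +_) r∈sh
  ...     | b , b∈B₀ , refl = +-monoʳ-< my (B≪A (∈-++⁺ˡ b∈B₀) a∈A)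
  R≪L r∈ l∈ | a , a∈A , refl | inj₂ r∈rest with ∈-++⁻ y r∈rest
  ...     | inj₁ r∈y = ≤-<-trans (≤-maxW y r∈y) (m<m+n my (positive Pz (∈-++⁺ˡ a∈A)))
  ...     | inj₂ (here refl) = subst (_< my + a) (+-comm my t) (+-monoʳ-< my (B≪A (∈-++⁺ʳ B₀ (here refl)) a∈A))

◁R-split : ∀ {x u} → Packed x → Packed u → GlobalDescentSplit u → GlobalDescentSplit (x ◁R u)
◁R-split {x} {u} Px Pu (L , R , L≢[] , R≢[] , R≪L , u≡) = P , R , P≢[] , R≢[] , R≪P , (begin
  x ◁R u                                               ≡⟨ ◁R-rep x u Pu u≢[] ⟩
  shiftW (pred mu) x ++ replaceW mu t u                ≡⟨ cong (λ v → shiftW (pred mu) x ++ replaceW mu t v) u≡ ⟩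
  shiftW (pred mu) x ++ replaceW mu t (L ++ R)         ≡⟨ cong (shiftW (pred mu) x ++_) (map-++ (replace mu t) L R) ⟩
  shiftW (pred mu) x ++ replaceW mu t L ++ replaceW mu t R
    ≡⟨ cong (λ s → shiftW (pred mu) x ++ replaceW mu t L ++ s) (replaceW-fresh t R (<⇒≢ ∘′ R<mu)) ⟩
  shiftW (pred mu) x ++ replaceW mu t L ++ R          ≡⟨ ++-assoc (shiftW (pred mu) x) _ R ⟨
  P ++ R                                               ∎)
  where
  mu t : ℕ
  mu = maxW u
  t = maxW x + mu
  P : Word
  P = shiftW (pred mu) x ++ replaceW mu t L
  u≢[] : u ≢ []
  u≢[] refl = L≢[] (++-conicalˡ L R (sym u≡))
  l₀∈L : maxW L ∈ L
  l₀∈L = maxW-∈ L L≢[]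
  R<mu : ∀ {r} → r ∈ R → r < mu
  R<mu r∈ = <-≤-trans (R≪L r∈ l₀∈L) (≤-maxW u (subst (_ ∈_) (sym u≡) (∈-++⁺ˡ l₀∈L)))
  P≢[] : P ≢ []
  P≢[] eq = map-≢[] (replace mu t) L≢[] (++-conicalʳ (shiftW (pred mu) x) _ eq)
  R≪P : R ≪ P
  R≪P {r} r∈ p∈ with ∈-++⁻ (shiftW (pred mu) x) p∈
  ... | inj₁ p∈sh = <-≤-trans (R<mu r∈)
    (subst (_≤ _) (suc-pred mu {{>-nonZero (maxW-positive Pu u≢[])}}) (proj₁ (∈-shiftW⁻ Px p∈sh)))
  ... | inj₂ p∈rep with ∈-replaceW⁻ L p∈rep
  ...   | inj₁ refl = <-≤-trans (R<mu r∈) (m≤n+m mu (maxW x))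
  ...   | inj₂ (p∈L , _) = R≪L r∈ p∈L

◁B-factor : ∀ {u Q Y t} → Packed u → u ≡ Q ++ Y ++ [ t ] → Y ≪ (Q ∷ʳ t) →
  ∃[ Z ] Packed Z × Z ≢ [] × u ≡ Y ◁B Z
◁B-factor {u} {Q} {Y} {t} Pu u≡ Y≪Qt = Z , PZ , Z≢[] , (begin
  u                                                   ≡⟨ u≡ ⟩
  Q ++ Y ++ [ t ]                                     ≡⟨ cong₂ (λ q s → q ++ Y ++ [ s ]) unshift (m∸n+n≡m (<⇒≤ (above t∈))) ⟨
  shiftW mY (map (_∸ mY) Q) ++ Y ++ [ t ∸ mY + mY ]   ≡⟨ ◁B-rep Y (map (_∸ mY) Q) (t ∸ mY) (m<n⇒0<n∸m (above t∈)) ⟨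
  Y ◁B Z                                              ∎)
  where
  mY : ℕ
  mY = maxW Y
  Z : Word
  Z = map (_∸ mY) Q ∷ʳ (t ∸ mY)
  Z≢[] : Z ≢ []
  Z≢[] Z≡[] with ++-conicalʳ (map (_∸ mY) Q) [ t ∸ mY ] Z≡[]
  ... | ()
  t∈ : t ∈ Q ∷ʳ t
  t∈ = ∈-++⁺ʳ Q (here refl)
  ∈u : ∀ {c} → c ∈ Q ∷ʳ t → c ∈ u
  ∈u c∈ with ∈-++⁻ Q c∈
  ... | inj₁ c∈Q = subst (_ ∈_) (sym u≡) (∈-++⁺ˡ c∈Q)
  ... | inj₂ (here refl) = subst (_ ∈_) (sym u≡) (∈-++⁺ʳ Q (∈-++⁺ʳ Y (here refl)))
  above : ∀ {c} → c ∈ Q ∷ʳ t → mY < c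
  above c∈ = maxW-<-least Y (positive Pu (∈u c∈)) (λ b∈ → Y≪Qt b∈ c∈)
  unshift : shiftW mY (map (_∸ mY) Q) ≡ Q
  unshift = trans (sym (map-∘ Q)) (map-id-∈ Q (λ c∈Q → m+[n∸m]≡n (<⇒≤ (above (∈-++⁺ˡ c∈Q)))))
  range : ∀ {a} → a ∈ Z → 1 ≤ a × a ≤ maxW u ∸ mY
  range a∈ with ∈-++⁻ (map (_∸ mY) Q) a∈
  ... | inj₁ a∈ₘ with ∈-map⁻ (_∸ mY) a∈ₘ
  ...   | c , c∈Q , refl = m<n⇒0<n∸m (above (∈-++⁺ˡ c∈Q)) , ∸-monoˡ-≤ mY (≤-maxW u (∈u (∈-++⁺ˡ c∈Q)))
  range a∈ | inj₂ (here refl) = m<n⇒0<n∸m (above t∈) , ∸-monoˡ-≤ mY (≤-maxW u (∈u t∈))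
  onto : ∀ {k} → 1 ≤ k → k ≤ maxW u ∸ mY → k ∈ Z
  onto {k} 1≤k k≤ with ∈-++⁻ Q (subst (k + mY ∈_) u≡ (packed-∈ Pu (≤-trans 1≤k (m≤m+n k mY))
    (subst (_≤ maxW u) (+-comm mY k) (≤-trans (+-monoʳ-≤ mY k≤) (≤-reflexive (m+[n∸m]≡n mY≤u))))))
    where
    mY≤u : mY ≤ maxW u
    mY≤u = <⇒≤ (<-≤-trans (above t∈) (≤-maxW u (∈u t∈)))
  ... | inj₁ k+mY∈Q = ∈-++⁺ˡ (subst (_∈ map (_∸ mY) Q) (m+n∸n≡m k mY) (∈-map⁺ (_∸ mY) k+mY∈Q))
  ... | inj₂ k+mY∈Yt with ∈-++⁻ Y k+mY∈Yt
  ...   | inj₁ k+mY∈Y = ⊥-elim (<⇒≱ (m<n+m mY 1≤k) (≤-maxW Y k+mY∈Y))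
  ...   | inj₂ (here k+mY≡t) = ∈-++⁺ʳ (map (_∸ mY) Q) (here (trans (sym (m+n∸n≡m k mY)) (cong (_∸ mY) k+mY≡t)))
  PZ : Packed Z
  PZ = packed-by-range Z (maxW u ∸ mY) range onto

∷ʳ-top : ∀ {W ℓ} → Packed (W ∷ʳ ℓ) → (∀ {a} → a ∈ W → a < ℓ) → Packed W × ℓ ≡ suc (maxW W)
∷ʳ-top {W} {ℓ} P below = PW , ≤-antisym (ℓ≤ ℓ refl) maxW<ℓ
  where
  ℓ∈ : ℓ ∈ W ∷ʳ ℓ
  ℓ∈ = ∈-++⁺ʳ W (here refl)
  maxW<ℓ : maxW W < ℓ
  maxW<ℓ = maxW-<-least W (positive P ℓ∈) below
  ∈W : ∀ {k} → 1 ≤ k → k < ℓ → k ∈ W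
  ∈W {k} 1≤k k<ℓ with ∈-++⁻ W (packed-∈ P 1≤k (≤-trans (<⇒≤ k<ℓ) (≤-maxW (W ∷ʳ ℓ) ℓ∈)))
  ... | inj₁ k∈W = k∈W
  ... | inj₂ (here refl) = ⊥-elim (<-irrefl refl k<ℓ)
  PW : Packed W
  PW = (λ a a∈ → positive P (∈-++⁺ˡ a∈)) , (λ k 1≤k k≤ → ∈W 1≤k (≤-<-trans k≤ maxW<ℓ))
  ℓ≤ : ∀ l → l ≡ ℓ → l ≤ suc (maxW W)
  ℓ≤ zero _ = z≤n
  ℓ≤ (suc zero) _ = s≤s z≤n
  ℓ≤ (suc (suc k)) refl = s≤s (≤-maxW W (∈W (s≤s z≤n) ≤-refl))

-- The shifted copy of x and the factor y′ share a letter e with max u ≤ e < ℓ, so the last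
-- letter ℓ of w cannot be a letter of u, and must be the renamed top letter.
◁R-◁B-overlap : ∀ {w x u y′ u′} → Packed w → Packed x → Packed u → u ≢ [] → Packed u′ → u′ ≢ [] →
  w ≡ x ◁R u → w ≡ y′ ◁B u′ → length w ≤ length x + length y′ →
  ∃[ W ] Packed W × w ≡ W ∷ʳ suc (maxW W)
◁R-◁B-overlap {w} {x} {u} {y′} {u′} Pw Px Pu u≢[] Pu′ u′≢[] w≡red w≡blue short with initLast u′
... | [] = ⊥-elim (u′≢[] refl)
... | p′ ∷ʳ′ i′ = lastIsTop (++-≡-∷ʳ-overlap A (replaceW mu M u) C y′ (trans (sym w≡AB) w≡Cyℓ) C<A (map-≢[] (replace mu M) u≢[]))
  where
  mu my M ℓ : ℕ
  mu = maxW u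
  my = maxW y′
  M = maxW x + mu
  ℓ = i′ + my
  A C : Word
  A = shiftW (pred mu) x
  C = shiftW my p′
  1≤mu : 1 ≤ mu
  1≤mu = maxW-positive Pu u≢[]
  w≡AB : w ≡ A ++ replaceW mu M u
  w≡AB = trans w≡red (◁R-rep x u Pu u≢[])
  w≡Cyℓ : w ≡ C ++ y′ ++ [ ℓ ]
  w≡Cyℓ = trans w≡blue (◁B-rep y′ p′ i′ (positive Pu′ (∈-++⁺ʳ p′ (here refl))))
  C<A : length C < length A
  C<A = subst₂ _<_ (sym (length-map _ p′)) (sym (length-map _ x))
    (+-cancelˡ-≤ (length y′) _ _ (subst₂ _≤_ |w|≡ (+-comm (length x) (length y′)) short))
    where
    |w|≡ : length w ≡ length y′ + suc (length p′)
    |w|≡ = trans (cong length w≡blue) (trans (length-◁B y′ Pu′ u′≢[]) (cong (length y′ +_) (length-∷ʳ p′ i′)))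
  y′<ℓ : ∀ {a} → a ∈ y′ → a < ℓ
  y′<ℓ a∈ = ≤-<-trans (≤-maxW y′ a∈) (m<n+m my (positive Pu′ (∈-++⁺ʳ p′ (here refl))))
  lastIsTop : (∃[ F ] replaceW mu M u ≡ F ∷ʳ ℓ × (∀ {a} → a ∈ F → a ∈ y′) × ∃[ e ] e ∈ A × e ∈ y′) →
    ∃[ W ] Packed W × w ≡ W ∷ʳ suc (maxW W)
  lastIsTop (F , B≡Fℓ , F⊆y′ , e , e∈A , e∈y′) = A ++ F , proj₁ top , trans w≡Wℓ (cong ((A ++ F) ∷ʳ_) (proj₂ top))
    where
    ℓ≡M : ℓ ≡ M
    ℓ≡M with ∈-replaceW⁻ u (subst (ℓ ∈_) (sym B≡Fℓ) (∈-++⁺ʳ F (here refl)))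
    ... | inj₁ ℓ≡ = ℓ≡
    ... | inj₂ (ℓ∈u , _) = ⊥-elim (<-irrefl refl (≤-<-trans (≤-trans (≤-maxW u ℓ∈u) mu≤e) (y′<ℓ e∈y′)))
      where
      mu≤e : mu ≤ e
      mu≤e = subst (_≤ e) (suc-pred mu {{>-nonZero 1≤mu}}) (proj₁ (∈-shiftW⁻ Px e∈A))
    w≡Wℓ : w ≡ (A ++ F) ∷ʳ ℓ
    w≡Wℓ = trans w≡AB (trans (cong (A ++_) B≡Fℓ) (sym (++-assoc A F [ ℓ ])))
    below : ∀ {a} → a ∈ A ++ F → a < ℓ
    below {a} a∈ with ∈-++⁻ A a∈
    ... | inj₁ a∈A = subst (a <_) (sym ℓ≡M) (≤-<-trans (proj₂ (∈-shiftW⁻ Px a∈A))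
            (subst (pred mu + maxW x <_) (+-comm mu (maxW x)) (+-monoˡ-< (maxW x) (pred< 1≤mu))))
    ... | inj₂ a∈F = y′<ℓ (F⊆y′ a∈F)
    top : Packed (A ++ F) × ℓ ≡ suc (maxW (A ++ F))
    top = ∷ʳ-top (subst Packed w≡Wℓ Pw) below

-- Here y′·ℓ lies inside the renamed copy of u, and y′ avoids max u, whose image exceeds ℓ.
◁R-◁B-disjoint : ∀ {w x u y′ u′} → Packed x → Packed u → u ≢ [] → Packed u′ → u′ ≢ [] →
  w ≡ x ◁R u → w ≡ y′ ◁B u′ → length x + length y′ < length w →
  ∃[ Z ] Packed Z × Z ≢ [] × u ≡ y′ ◁B Z
◁R-◁B-disjoint {w} {x} {u} {y′} {u′} Px Pu u≢[] Pu′ u′≢[] w≡red w≡blue long with initLast u′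
... | [] = ⊥-elim (u′≢[] refl)
... | p′ ∷ʳ′ i′ = factor (++-overlap C (y′ ++ [ ℓ ]) A (replaceW mu M u) (trans (sym w≡Cyℓ) w≡AB) A≤C)
  where
  mu my M ℓ : ℕ
  mu = maxW u
  my = maxW y′
  M = maxW x + mu
  ℓ = i′ + my
  A C : Word
  A = shiftW (pred mu) x
  C = shiftW my p′
  w≡AB : w ≡ A ++ replaceW mu M u
  w≡AB = trans w≡red (◁R-rep x u Pu u≢[])
  w≡Cyℓ : w ≡ C ++ y′ ++ [ ℓ ]
  w≡Cyℓ = trans w≡blue (◁B-rep y′ p′ i′ (positive Pu′ (∈-++⁺ʳ p′ (here refl))))
  A≤C : length A ≤ length C
  A≤C = subst₂ _≤_ (sym (length-map _ x)) (sym (length-map _ p′))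
    (≤-pred (+-cancelˡ-≤ (length y′) _ _ (subst₂ _≤_ |xy|≡ |w|≡ long)))
    where
    |xy|≡ : suc (length x + length y′) ≡ length y′ + suc (length x)
    |xy|≡ = trans (cong suc (+-comm (length x) (length y′))) (sym (+-suc (length y′) (length x)))
    |w|≡ : length w ≡ length y′ + suc (length p′)
    |w|≡ = trans (cong length w≡blue) (trans (length-◁B y′ Pu′ u′≢[]) (cong (length y′ +_) (length-∷ʳ p′ i′)))
  my<ℓ : my < ℓ
  my<ℓ = m<n+m my (positive Pu′ (∈-++⁺ʳ p′ (here refl)))
  ℓ≤M : ℓ ≤ M
  ℓ≤M = subst (ℓ ≤_) (maxW-◁R Px Pu u≢[])
    (≤-maxW (x ◁R u) (subst (ℓ ∈_) (trans (sym w≡Cyℓ) w≡red) (∈-++⁺ʳ C (∈-++⁺ʳ y′ (here refl)))))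
  factor : (∃[ E ] C ≡ A ++ E × replaceW mu M u ≡ E ++ y′ ++ [ ℓ ]) → ∃[ Z ] Packed Z × Z ≢ [] × u ≡ y′ ◁B Z
  factor (E , C≡AE , B≡Eyℓ) with map-≡-++-∷ʳ (replace mu M) u E y′ B≡Eyℓ
  ... | Q , R , t , u≡QRt , rQ≡E , rR≡y′ , rt≡ℓ = ◁B-factor Pu u≡Qyt y′≪Qt
    where
    R∈u : ∀ {r} → r ∈ R → r ∈ u
    R∈u {r} r∈ = subst (r ∈_) (sym u≡QRt) (∈-++⁺ʳ Q (∈-++⁺ˡ r∈))
    R≢mu : ∀ {r} → r ∈ R → r ≢ mu
    R≢mu r∈ refl = <-irrefl refl (<-≤-trans (≤-<-trans (≤-maxW y′ M∈y′) my<ℓ) ℓ≤M)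
      where
      M∈y′ : M ∈ y′
      M∈y′ = subst (M ∈_) rR≡y′ (∈-replaceW-target r∈)
    R≡y′ : R ≡ y′
    R≡y′ = trans (sym (replaceW-fresh M R R≢mu)) rR≡y′
    u≡Qyt : u ≡ Q ++ y′ ++ [ t ]
    u≡Qyt = trans u≡QRt (cong (λ r → Q ++ r ++ [ t ]) R≡y′)
    y′<mu : ∀ {b} → b ∈ y′ → b < mu
    y′<mu {b} b∈ = let b∈R = subst (b ∈_) (sym R≡y′) b∈ in ≤∧≢⇒< (≤-maxW u (R∈u b∈R)) (R≢mu b∈R)
    C-above : ∀ {c} → c ∈ C → my < c
    C-above = shiftW-above (λ a∈ → positive Pu′ (∈-++⁺ˡ a∈))
    y′≪Qt : y′ ≪ (Q ∷ʳ t)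
    y′≪Qt {b} {c} b∈ c∈ with ∈-++⁻ Q c∈
    ... | inj₁ c∈Q = <-replace⁻ (y′<mu b∈) (≤-<-trans (≤-maxW y′ b∈) (C-above
      (subst (replace mu M c ∈_) (sym C≡AE) (∈-++⁺ʳ A (subst (replace mu M c ∈_) rQ≡E (∈-map⁺ (replace mu M) c∈Q))))))
    ... | inj₂ (here refl) = <-replace⁻ (y′<mu b∈) (subst (b <_) (sym rt≡ℓ) (≤-<-trans (≤-maxW y′ b∈) my<ℓ))

redFact-∷ʳ-top : ∀ {W x u} → Packed W → IsRedFact (W ∷ʳ suc (maxW W)) x u → x ≡ W × u ≡ [ 1 ]
redFact-∷ʳ-top {W} {x} {u} PW (Px , Pu , u≢[] , w≡ , maximal) =
  ◁R-cancel Px Pu u≢[] PW [1]-packed [1]≢[] (trans (sym w≡) (sym (◁R-[1] W))) (≤-antisym x≤W W≤x)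
  where
  W≤x : length W ≤ length x
  W≤x = maximal W [ 1 ] PW [1]-packed [1]≢[] (sym (◁R-[1] W))
  x≤W : length x ≤ length W
  x≤W = +-cancelʳ-≤ 1 _ _ (≤-trans (+-monoʳ-≤ (length x) (≢[]⇒length-positive u≢[]))
    (≤-reflexive (trans (sym (length-◁R x Pu u≢[])) (trans (cong length (sym w≡)) (length-++ W)))))

blueFact-∷ʳ-top : ∀ {W y u} → Packed W → IsBlueFact (W ∷ʳ suc (maxW W)) y u → y ≡ W × u ≡ [ 1 ]
blueFact-∷ʳ-top {W} {y} {u} PW (Py , Pu , u≢[] , w≡ , maximal) =
  ◁B-cancel Pu u≢[] [1]-packed [1]≢[] (trans (sym w≡) (sym (◁B-[1] W))) (≤-antisym y≤W W≤y)
  where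
  W≤y : length W ≤ length y
  W≤y = maximal W [ 1 ] PW [1]-packed [1]≢[] (sym (◁B-[1] W))
  y≤W : length y ≤ length W
  y≤W = +-cancelʳ-≤ 1 _ _ (≤-trans (+-monoʳ-≤ (length y) (≢[]⇒length-positive u≢[]))
    (≤-reflexive (trans (sym (length-◁B y Pu u≢[])) (trans (cong length (sym w≡)) (length-++ W)))))

redBlue-swap : ∀ {w x u y z} → IsRedFact w x u → IsBlueFact u y z → w ≡ y ◁B (x ◁R z)
redBlue-swap (Px , _ , _ , w≡ , _) (Py , Pz , z≢[] , u≡ , _) =
  trans w≡ (trans (cong (_ ◁R_) u≡) (sym (◁B-◁R-comm Py Px Pz z≢[])))

blueRed-swap : ∀ {w y u x z} → IsBlueFact w y u → IsRedFact u x z → w ≡ x ◁R (y ◁B z)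
blueRed-swap (Py , _ , _ , w≡ , _) (Px , Pz , z≢[] , u≡ , _) =
  trans w≡ (trans (cong (_ ◁B_) u≡) (◁B-◁R-comm Py Px Pz z≢[]))

redBlue-irreducible : ∀ {w x u y z} → Irreducible w → IsRedFact w x u → IsBlueFact u y z → Irreducible z
redBlue-irreducible (_ , irreducible) (Px , Pu , _ , w≡ , _) (_ , Pz , z≢[] , u≡ , _) = z≢[] , λ (_ , descent) →
  irreducible (split⇒globalDescent (subst GlobalDescentSplit (sym w≡)
    (◁R-split Px Pu (subst GlobalDescentSplit (sym u≡) (◁B-split Pz (globalDescent⇒split descent))))))

redBlue-◁R-free : ∀ {w x u y z} → IsRedFact w x u → IsBlueFact u y z →
  ∀ a b → Packed a → Packed b → b ≢ [] → z ≡ a ◁R b → a ≡ []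
redBlue-◁R-free {w} {x} {u} {y} (Px , Pu , _ , w≡ , maximal) (Py , _ , _ , u≡ , _) a b Pa Pb b≢[] z≡ =
  +-length-≤⇒[] (length x) (subst (_≤ length x) (length-⊙ x a) (maximal (x ⊙ a) (y ◁B b) (⊙-packed Px Pa)
    (◁B-packed Py Pb b≢[]) (◁B-≢[] y Pb b≢[]) (begin
      w                      ≡⟨ w≡ ⟩
      x ◁R u                 ≡⟨ cong (x ◁R_) (trans u≡ (cong (y ◁B_) z≡)) ⟩
      x ◁R (y ◁B (a ◁R b))   ≡⟨ cong (x ◁R_) (◁B-◁R-comm Py Pa Pb b≢[]) ⟩
      x ◁R (a ◁R (y ◁B b))   ≡⟨ ◁R-assoc Px Pa (◁B-packed Py Pb b≢[]) (◁B-≢[] y Pb b≢[]) ⟩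
      (x ⊙ a) ◁R (y ◁B b)    ∎)))

blueFact-◁B-free : ∀ {u y z} → IsBlueFact u y z → ∀ a b → Packed a → Packed b → b ≢ [] → z ≡ a ◁B b → a ≡ []
blueFact-◁B-free {u} {y} (Py , _ , _ , u≡ , maximal) a b Pa Pb b≢[] z≡ =
  +-length-≤⇒[] (length y) (subst (_≤ length y) (trans (length-⊙ a y) (+-comm (length a) (length y)))
    (maximal (a ⊙ y) b (⊙-packed Pa Py) Pb b≢[] (trans u≡ (trans (cong (y ◁B_) z≡) (◁B-assoc Pb b≢[])))))

redBlue-blueRed-overlapping : ∀ {w x u y z y′ u′ x′ z′} → Packed w →
  IsRedFact w x u → IsBlueFact u y z → IsBlueFact w y′ u′ → IsRedFact u′ x′ z′ →
  length w ≤ length x + length y′ → z ≡ [ 1 ] × z′ ≡ [ 1 ] × y ≡ [] × x′ ≡ [] × x ≡ y′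
redBlue-blueRed-overlapping Pw red@(Px , Pu , u≢[] , w≡red , _) (_ , Pz , z≢[] , u≡ , _)
  blue′@(_ , Pu′ , u′≢[] , w≡blue , _) (_ , Pz′ , z′≢[] , u′≡ , _) overlapping
  with ◁R-◁B-overlap Pw Px Pu u≢[] Pu′ u′≢[] w≡red w≡blue overlapping
... | W , PW , refl with redFact-∷ʳ-top PW red | blueFact-∷ʳ-top PW blue′
... | x≡W , u≡[1] | y′≡W , u′≡[1] with ◁B-≡[1] Pz z≢[] (trans (sym u≡) u≡[1]) | ◁R-≡[1] Pz′ z′≢[] (trans (sym u′≡) u′≡[1])
... | y≡[] , z≡[1] | x′≡[] , z′≡[1] = z≡[1] , z′≡[1] , y≡[] , x′≡[] , trans x≡W (sym y′≡W)

redBlue-blueRed-disjoint : ∀ {w x u y z y′ u′ x′ z′} →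
  IsRedFact w x u → IsBlueFact u y z → IsBlueFact w y′ u′ → IsRedFact u′ x′ z′ →
  length x + length y′ < length w → x ≡ x′ × y ≡ y′ × z ≡ z′
redBlue-blueRed-disjoint {w} {x} {u} {y} {z} {y′} {u′} {x′} {z′}
  red@(Px , Pu , u≢[] , w≡red , maxRed) blue@(Py , Pz , z≢[] , _ , maxBlue)
  blue′@(Py′ , Pu′ , u′≢[] , w≡blue , maxBlue′) red′@(Px′ , Pz′ , z′≢[] , u′≡ , maxRed′) disjoint
  with ◁R-◁B-disjoint Px Pu u≢[] Pu′ u′≢[] w≡red w≡blue disjoint
... | Z , PZ , Z≢[] , u≡ = proj₁ same-red , proj₁ same-blue , proj₂ same-red
  where
  y≤y′ : length y ≤ length y′
  y≤y′ = maxBlue′ y (x ◁R z) Py (◁R-packed Px Pz z≢[]) (◁R-≢[] x Pz z≢[]) (redBlue-swap red blue)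
  x′≤x : length x′ ≤ length x
  x′≤x = maxRed x′ (y′ ◁B z′) Px′ (◁B-packed Py′ Pz′ z′≢[]) (◁B-≢[] y′ Pz′ z′≢[]) (blueRed-swap blue′ red′)
  y′≤y : length y′ ≤ length y
  y′≤y = maxBlue y′ Z Py′ PZ Z≢[] u≡
  u′≡xZ : u′ ≡ x ◁R Z
  u′≡xZ = proj₂ (◁B-cancel Pu′ u′≢[] (◁R-packed Px PZ Z≢[]) (◁R-≢[] x PZ Z≢[]) (begin
    y′ ◁B u′          ≡⟨ w≡blue ⟨
    w                 ≡⟨ w≡red ⟩
    x ◁R u            ≡⟨ cong (x ◁R_) u≡ ⟩
    x ◁R (y′ ◁B Z)    ≡⟨ ◁B-◁R-comm Py′ Px PZ Z≢[] ⟨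
    y′ ◁B (x ◁R Z)    ∎) refl)
  x≤x′ : length x ≤ length x′
  x≤x′ = maxRed′ x Z Px PZ Z≢[] u′≡xZ
  same-blue : y ≡ y′ × x ◁R z ≡ x′ ◁R z′
  same-blue = ◁B-cancel (◁R-packed Px Pz z≢[]) (◁R-≢[] x Pz z≢[]) (◁R-packed Px′ Pz′ z′≢[]) (◁R-≢[] x′ Pz′ z′≢[])
    (trans (sym (redBlue-swap red blue)) (trans w≡blue (cong (y′ ◁B_) u′≡))) (≤-antisym y≤y′ y′≤y)
  same-red : x ≡ x′ × z ≡ z′
  same-red = ◁R-cancel Px Pz z≢[] Px′ Pz′ z′≢[] (proj₂ same-blue) (≤-antisym x≤x′ x′≤x)

mainTheorem14 : (w x u y z y′ u′ x′ z′ : Word) →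
    Packed w → Irreducible w →
    IsRedFact w x u → IsBlueFact u y z →
    IsBlueFact w y′ u′ → IsRedFact u′ x′ z′ →
    z ≡ z′ × RedIrreducible z × BlueIrreducible z ×
    ((z ≡ [ 1 ] × z′ ≡ [ 1 ] × y ≡ [] × x′ ≡ [] × x ≡ y′) ⊎ (x ≡ x′ × y ≡ y′))
mainTheorem14 w x u y z y′ u′ x′ z′ Pw Iw red blue blue′ red′ =
  proj₁ comparison , (Pz , Iz , redBlue-◁R-free red blue) , (Pz , Iz , blueFact-◁B-free blue) , proj₂ comparison
  where
  Pz : Packed z
  Pz = proj₁ (proj₂ blue)
  Iz : Irreducible z
  Iz = redBlue-irreducible Iw red blue
  comparison : z ≡ z′ × ((z ≡ [ 1 ] × z′ ≡ [ 1 ] × y ≡ [] × x′ ≡ [] × x ≡ y′) ⊎ (x ≡ x′ × y ≡ y′))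
  comparison with length x + length y′ <? length w
  ... | yes disjoint = let (x≡x′ , y≡y′ , z≡z′) = redBlue-blueRed-disjoint red blue blue′ red′ disjoint in
    z≡z′ , inj₂ (x≡x′ , y≡y′)
  ... | no overlapping = let (z≡[1] , z′≡[1] , y≡[] , x′≡[] , x≡y′) = redBlue-blueRed-overlapping Pw red blue blue′ red′ (≮⇒≥ overlapping) in
    trans z≡[1] (sym z′≡[1]) , inj₁ (z≡[1] , z′≡[1] , y≡[] , x′≡[] , x≡y′)
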